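{- Let $r\ge2$, $m\ge1$ and $0\le s\le k$ be integers with $k\ge1$. Then $\operatorname{forb}(m,r,K_k^s)=\sum_{i=0}^{k-1}\binom{m}{i}(r-1)^{m-i}$. If $p\ge1$ is an integer with $(r-2)^{m-k}\ge p-1$, then \[\operatorname{forb}(m,r,p\cdot K_k^s)=\operatorname{forb}(m,r,K_k^s)+(p-1)\binom{m}{k}.\]
   Context: An $r$-matrix is a matrix with entries in $\{0,1,\dots,r-1\}$. A matrix is simple if it has no repeated columns. For matrices $F$ and $A$, $A$ avoids $F$ if no submatrix of $A$ is a row and column permutation of $F$. $\operatorname{forb}(m,r,F)$ is the maximum number of columns of a simple $m$-rowed $r$-matrix that avoids $F$. $K_k^s$ is the $k\times\binom{k}{s}$ $(0,1)$-matrix whose columns are all distinct $(0,1)$-vectors of length $k$ with exactly $s$ ones. For a positive integer $p$, $p\cdot F$ denotes $p$ copies of $F$ placed side by side (each column repeated $p$ times). -}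

module Defs where

open import Data.Nat using (ℕ; zero; suc; _+_; _*_; _∸_; _^_; _≤_; _≟_)
open import Data.Nat.Combinatorics using (_C_)
open import Data.Fin using (Fin; toℕ)
open import Data.Vec using (Vec; []; _∷_; lookup)
open import Data.List using (List; [_]; _++_; map; filter; length; concatMap; replicate; upTo)
open import Data.Nat.ListAction using (sum)
import Data.List as L
open import Data.Product using (Σ; _×_)
open import Relation.Binary.PropositionalEquality using (_≡_)

Matrix : ℕ → ℕ → ℕ → Set
Matrix m n r = Fin m → Fin n → Fin r

Simple : ∀ {m n r} → Matrix m n r → Set
Simple {m} {n} A = (j j′ : Fin n) → ((i : Fin m) → A i j ≡ A i j′) → j ≡ j′

Injective : ∀ {a b} → (Fin a → Fin b) → Set
Injective {a} f = (x y : Fin a) → f x ≡ f y → x ≡ y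

-- A (0,1)-matrix with k rows is given as a list of its columns
-- (column order is irrelevant for containment up to column permutation).
Config : ℕ → Set
Config k = List (Vec (Fin 2) k)

-- A contains F: some k×|F| submatrix of A (distinct rows, distinct columns)
-- is a row and column permutation of F.
Contains : ∀ {m n r k} → Matrix m n r → Config k → Set
Contains {m} {n} {r} {k} A F =
  Σ (Fin k → Fin m) λ ρ → Σ (Fin (length F) → Fin n) λ γ →
    Injective ρ × Injective γ ×
    ((i : Fin k) (j : Fin (length F)) → toℕ (A (ρ i) (γ j)) ≡ toℕ (lookup (L.lookup F j) i))

Avoids : ∀ {m n r k} → Matrix m n r → Config k → Set
Avoids A F = Contains A F → Data.Empty.⊥
  where import Data.Empty

-- forb(m,r,F) = N  : N is the maximum number of columns of a simple
-- m-rowed r-matrix avoiding F (attained, and an upper bound).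
IsForb : ℕ → ℕ → ∀ {k} → Config k → ℕ → Set
IsForb m r F N =
  Σ (Matrix m N r) (λ A → Simple A × Avoids A F) ×
  ((n : ℕ) (A : Matrix m n r) → Simple A → Avoids A F → n ≤ N)

allCols : (k : ℕ) → List (Vec (Fin 2) k)
allCols zero = [ [] ]
allCols (suc k) = map (Fin.zero ∷_) (allCols k) ++ map (Fin.suc Fin.zero ∷_) (allCols k)
  where import Data.Fin as Fin

ones : ∀ {k} → Vec (Fin 2) k → ℕ
ones [] = 0
ones (x ∷ v) = toℕ x + ones v

K : (k s : ℕ) → Config k
K k s = filter (λ v → ones v ≟ s) (allCols k)

_·_ : ∀ {k} → ℕ → Config k → Config k
p · F = concatMap (replicate p) F

bound : ℕ → ℕ → ℕ → ℕ
bound m r k = sum (map (λ i → (m C i) * ((r ∸ 1) ^ (m ∸ i))) (upTo k))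

-- Part one, upper bound: a shifting argument on the first row (module Shift, lemma
-- shifting-bound) gives the recursion of bound (bound-rec), for any family of
-- forbidden (0,1)-columns. Part one, lower bound: read each column from the top
-- counting "marks", where the expected symbol is 0 until k ∸ s marks were seen and 1
-- afterwards (module Marking); the columns with fewer than k marks are exactly
-- bound m r k many, and every copy of K_k^s would need a column with k marks.
-- Part two, upper bound (module RareColumns): for every k-set of rows some column of
-- K_k^s is matched by at most p - 1 columns, otherwise a greedy embedding gives p·K_k^s;
-- deleting these columns leaves a matrix avoiding K_k^s. Part two, lower bound (module
-- PartTwoConstruction): add, for every k-set of rows, p - 1 columns with k marks,
-- distinguished by their entries ≥ 2 outside the k rows (module Extension).
module Submission where

open import Defs
open import Data.Nat using (ℕ; zero; suc; _+_; _*_; _∸_; _^_; _≤_; _<_; z≤n; s≤s; _≤ᵇ_; _≤?_; _<?_)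
open import Data.Nat.Properties
open import Data.Nat.Combinatorics using (_C_; k>n⇒nCk≡0; nCk+nC[k+1]≡[n+1]C[k+1])
import Data.Nat.ListAction as ListAction
open import Data.Fin as F using (Fin; zero; suc; toℕ; punchIn)
import Data.Fin.Properties as FP
open import Data.Bool using (Bool; true; false; T; _∧_; _∨_; not)
open import Data.Bool.Properties using (T-∧; T-∨; ∧-assoc; ∧-comm)
open import Data.Empty using (⊥; ⊥-elim)
open import Data.Unit using (⊤; tt)
open import Data.Product using (_×_; _,_; Σ; proj₁; proj₂; ∃; ∃₂)
open import Data.Sum using (_⊎_; inj₁; inj₂)
open import Data.List as L using (List; []; _∷_; _++_)
import Data.List.Properties as LP
open import Data.List.Membership.Propositional using (_∈_; find; lose)
open import Data.List.Membership.Propositional.Properties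
open import Data.List.Relation.Unary.All as All using (All; []; _∷_)
open import Data.List.Relation.Unary.Any as Any using (here; there)
import Data.List.Relation.Unary.Any.Properties as AnyP
open import Data.List.Relation.Unary.AllPairs using ([]; _∷_)
open import Data.List.Relation.Unary.Unique.Propositional using (Unique)
import Data.List.Relation.Unary.Unique.Propositional.Properties as UP
open import Data.Vec as V using (Vec; []; _∷_)
import Data.Vec.Properties as VP
open import Function using (_∘_; Equivalence)
open import Relation.Binary.PropositionalEquality
open import Relation.Nullary using (Dec; yes; no; does; ¬_)
open import Relation.Nullary.Decidable using (_×-dec_)
open import Algebra.Properties.Semiring.Sum +-*-semiring
  using (sum; sum-syntax; ∑-distrib-+; ∑-comm; sum-cong-≗; *-distribˡ-sum)

open Equivalence using (to; from)

ind : Bool → ℕ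
ind true  = 1
ind false = 0

_==_ : ∀ {n} → Fin n → Fin n → Bool
x == y = does (x FP.≟ y)

does⇒ : ∀ {P : Set} (d : Dec P) → T (does d) → P
does⇒ (yes p) _ = p

not-does⇒ : ∀ {P : Set} (d : Dec P) → T (not (does d)) → ¬ P
not-does⇒ (no ¬p) _ = ¬p

T-not : ∀ {b} → T (not b) → ¬ T b
T-not {true} () _

⇒does : ∀ {P : Set} (d : Dec P) → P → T (does d)
⇒does (yes _) _ = tt
⇒does (no ¬p) p = ¬p p

==⇒≡ : ∀ {n} (x y : Fin n) → T (x == y) → x ≡ y
==⇒≡ x y = does⇒ (x FP.≟ y)

ind-==-refl : ∀ {n} (x : Fin n) → ind (x == x) ≡ 1
ind-==-refl x with x FP.≟ x
... | yes _ = refl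
... | no x≢x = ⊥-elim (x≢x refl)

ind-==-≢ : ∀ {n} (x y : Fin n) → x ≢ y → ind (x == y) ≡ 0
ind-==-≢ x y x≢y with x FP.≟ y
... | yes x≡y = ⊥-elim (x≢y x≡y)
... | no _ = refl

T⇒ind≡1 : ∀ {b} → T b → ind b ≡ 1
T⇒ind≡1 {true} _ = refl

¬T⇒ind≡0 : ∀ {b} → ¬ T b → ind b ≡ 0
¬T⇒ind≡0 {true} ¬t = ⊥-elim (¬t tt)
¬T⇒ind≡0 {false} _ = refl

∑-const : ∀ n c → ∑[ j < n ] c ≡ n * c
∑-const zero c = refl
∑-const (suc n) c = cong (c +_) (∑-const n c)

∑-zero : ∀ {n} (f : Fin n → ℕ) → (∀ j → f j ≡ 0) → ∑[ j < n ] f j ≡ 0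
∑-zero {n} f f≡0 = trans (sum-cong-≗ f≡0) (trans (∑-const n 0) (*-zeroʳ n))

∑-mono : ∀ {n} (f g : Fin n → ℕ) → (∀ j → f j ≤ g j) → ∑[ j < n ] f j ≤ ∑[ j < n ] g j
∑-mono {zero} f g f≤g = z≤n
∑-mono {suc n} f g f≤g = +-mono-≤ (f≤g zero) (∑-mono (f ∘ suc) (g ∘ suc) (f≤g ∘ suc))

∑-point : ∀ {n} (a : Fin n) (f : Fin n → ℕ) → ∑[ j < n ] (ind (a == j) * f j) ≡ f a
∑-point {suc n} zero f =
  trans (cong₂ _+_ (+-identityʳ (f zero)) (∑-zero {n} _ (λ _ → refl))) (+-identityʳ (f zero))
∑-point {suc n} (suc a) f = ∑-point a (f ∘ suc)

∑-indicator : ∀ {n} (a : Fin n) → ∑[ j < n ] ind (a == j) ≡ 1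
∑-indicator a = trans (sum-cong-≗ (λ j → sym (*-identityʳ (ind (a == j))))) (∑-point a (λ _ → 1))

Sel : ℕ → Set
Sel n = Fin n → Bool

size : ∀ {n} → Sel n → ℕ
size {n} sel = ∑[ j < n ] ind (sel j)

size-none : ∀ {n} (sel : Sel n) → (∀ j → ¬ T (sel j)) → size sel ≡ 0
size-none sel none = ∑-zero _ (λ j → ¬T⇒ind≡0 (none j))

size-all : ∀ n → size {n} (λ _ → true) ≡ n
size-all n = trans (∑-const n 1) (*-identityʳ n)

size-mono : ∀ {n} (a b : Sel n) → (∀ j → T (a j) → T (b j)) → size a ≤ size b
size-mono a b a⊆b = ∑-mono _ _ (λ j → lemma (a j) (b j) (a⊆b j))
  where
  lemma : ∀ x y → (T x → T y) → ind x ≤ ind y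
  lemma true true _ = ≤-refl
  lemma true false x⇒y = ⊥-elim (x⇒y tt)
  lemma false y _ = z≤n

size-≤ : ∀ {n} (sel : Sel n) → size sel ≤ n
size-≤ sel = subst (size sel ≤_) (size-all _) (size-mono sel (λ _ → true) (λ _ _ → tt))

size-atMostOne : ∀ {n} (sel : Sel n) → (∀ j j′ → T (sel j) → T (sel j′) → j ≡ j′) → size sel ≤ 1
size-atMostOne {zero} sel _ = z≤n
size-atMostOne {suc n} sel one with sel zero in eq
... | true = ≤-reflexive (cong suc (size-none (sel ∘ suc) (λ j t → 0≢suc (one zero (suc j) (subst T (sym eq) tt) t))))
  where
  0≢suc : ∀ {j : Fin n} → F.zero ≢ suc j
  0≢suc ()
... | false = size-atMostOne (sel ∘ suc) (λ j j′ t t′ → FP.suc-injective (one (suc j) (suc j′) t t′))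

size-pos : ∀ {n} (sel : Sel n) → 1 ≤ size sel → ∃ λ j → T (sel j)
size-pos {suc n} sel pos with sel zero in eq
... | true = zero , subst T (sym eq) tt
... | false = let j , t = size-pos (sel ∘ suc) pos in suc j , t

size-∨ : ∀ {n} (a b : Sel n) → size (λ j → a j ∨ b j) ≤ size a + size b
size-∨ a b = ≤-trans (∑-mono _ _ (λ j → lemma (a j) (b j))) (≤-reflexive (∑-distrib-+ (ind ∘ a) (ind ∘ b)))
  where
  lemma : ∀ x y → ind (x ∨ y) ≤ ind x + ind y
  lemma true y = s≤s z≤n
  lemma false y = ≤-refl

size-complement : ∀ {n} (b : Sel n) → n ≡ size (not ∘ b) + size b
size-complement {n} b =
  trans (sym (size-all n)) (trans (sum-cong-≗ (λ j → lemma (b j))) (∑-distrib-+ (ind ∘ not ∘ b) (ind ∘ b)))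
  where
  lemma : ∀ x → 1 ≡ ind (not x) + ind x
  lemma true = refl
  lemma false = refl

size-remove : ∀ {n} (sel : Sel n) (j₀ : Fin n) → size sel ≡ size (λ j → sel j ∧ not (j₀ == j)) + ind (sel j₀)
size-remove sel j₀ = trans (sum-cong-≗ (λ j → lemma (sel j) (j₀ == j)))
  (trans (∑-distrib-+ (λ j → ind (sel j ∧ not (j₀ == j))) (λ j → ind (j₀ == j) * ind (sel j)))
    (cong (size (λ j → sel j ∧ not (j₀ == j)) +_) (∑-point j₀ (ind ∘ sel))))
  where
  lemma : ∀ a b → ind a ≡ ind (a ∧ not b) + ind b * ind a
  lemma true true = refl
  lemma true false = refl
  lemma false true = refl
  lemma false false = refl

size-partition : ∀ {n} M (sel : Sel n) (h : Fin n → Fin M) →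
  size sel ≡ ∑[ a < M ] size (λ j → sel j ∧ (h j == a))
size-partition M sel h =
  trans (sum-cong-≗ pointwise) (∑-comm (λ j a → ind (sel j ∧ (h j == a))))
  where
  pointwise : ∀ j → ind (sel j) ≡ ∑[ a < M ] ind (sel j ∧ (h j == a))
  pointwise j with sel j
  ... | true = sym (∑-indicator (h j))
  ... | false = sym (∑-zero {M} _ (λ _ → refl))

size-pigeonhole : ∀ {n} M (sel : Sel n) (g : Fin n → Fin (suc M)) →
  (∀ j → T (sel j) → g j ≢ zero) →
  (∀ j j′ → T (sel j) → T (sel j′) → g j ≡ g j′ → j ≡ j′) → size sel ≤ M
size-pigeonhole M sel g nonzero distinct = begin
  size sel                                      ≡⟨ size-partition (suc M) sel g ⟩
  size (label zero) + ∑[ a < M ] size (label (suc a))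
    ≡⟨ cong (_+ ∑[ a < M ] size (label (suc a))) (size-none (label zero) labelled-0) ⟩
  ∑[ a < M ] size (label (suc a))               ≤⟨ ∑-mono _ _ (λ a → size-atMostOne (label (suc a)) (unique a)) ⟩
  ∑[ a < M ] 1                                  ≡⟨ ∑-const M 1 ⟩
  M * 1                                         ≡⟨ *-identityʳ M ⟩
  M                                             ∎
  where
  open ≤-Reasoning
  label : Fin (suc M) → Sel _
  label a j = sel j ∧ (g j == a)
  labelled-0 : ∀ j → ¬ T (label zero j)
  labelled-0 j t = let s , e = to T-∧ t in nonzero j s (==⇒≡ _ _ e)
  unique : ∀ a j j′ → T (label (suc a) j) → T (label (suc a) j′) → j ≡ j′
  unique a j j′ t t′ with to T-∧ t | to T-∧ t′
  ... | s , e | s′ , e′ = distinct j j′ s s′ (trans (==⇒≡ _ _ e) (sym (==⇒≡ _ _ e′)))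

inImage : ∀ {k m} → (Fin k → Fin m) → Sel m
inImage ρ j = does (FP.any? (λ i → ρ i FP.≟ j))

inImage-intro : ∀ {k m} (ρ : Fin k → Fin m) i → T (inImage ρ (ρ i))
inImage-intro ρ i with FP.any? (λ i′ → ρ i′ FP.≟ ρ i)
... | yes _ = tt
... | no none = none (i , refl)

inImage-elim : ∀ {k m} (ρ : Fin k → Fin m) j → T (inImage ρ j) → ∃ λ i → ρ i ≡ j
inImage-elim ρ j t with FP.any? (λ i → ρ i FP.≟ j)
... | yes found = found

∑-image : ∀ {k m} (ρ : Fin k → Fin m) → Injective ρ → (f : Fin m → ℕ) →
  ∑[ i < k ] f (ρ i) ≡ ∑[ j < m ] (ind (inImage ρ j) * f j)
∑-image {zero} {m} ρ _ f = sym (∑-zero {m} _ (λ _ → refl))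
∑-image {suc k} {m} ρ inj f = begin
  f (ρ zero) + ∑[ i < k ] f (ρ′ i)
    ≡⟨ cong₂ _+_ (sym (∑-point (ρ zero) f)) (∑-image ρ′ inj′ f) ⟩
  ∑[ j < m ] (ind (ρ zero == j) * f j) + ∑[ j < m ] (ind (inImage ρ′ j) * f j)
    ≡⟨ sym (∑-distrib-+ (λ j → ind (ρ zero == j) * f j) (λ j → ind (inImage ρ′ j) * f j)) ⟩
  ∑[ j < m ] (ind (ρ zero == j) * f j + ind (inImage ρ′ j) * f j)
    ≡⟨ sum-cong-≗ (λ j → disjoint-∨ (ρ zero == j) (inImage ρ′ j) (f j) (fresh j)) ⟩
  ∑[ j < m ] (ind (inImage ρ j) * f j) ∎
  where
  open ≡-Reasoning
  ρ′ : Fin k → Fin m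
  ρ′ = ρ ∘ suc
  inj′ : Injective ρ′
  inj′ x y e = FP.suc-injective (inj (suc x) (suc y) e)
  fresh : ∀ j → T (ρ zero == j) → ¬ T (inImage ρ′ j)
  fresh j t t′ with inImage-elim ρ′ j t′
  ... | i , ρ′i≡j with inj zero (suc i) (trans (==⇒≡ _ _ t) (sym ρ′i≡j))
  ... | ()
  disjoint-∨ : ∀ a b x → (T a → ¬ T b) → ind a * x + ind b * x ≡ ind (a ∨ b) * x
  disjoint-∨ true true x d = ⊥-elim (d tt tt)
  disjoint-∨ true false x d = +-identityʳ _
  disjoint-∨ false b x d = refl

size-image : ∀ {k m} (ρ : Fin k → Fin m) → Injective ρ → size (inImage ρ) ≡ k
size-image {k} {m} ρ inj = begin
  ∑[ j < m ] ind (inImage ρ j)         ≡⟨ sum-cong-≗ (λ j → sym (*-identityʳ (ind (inImage ρ j)))) ⟩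
  ∑[ j < m ] (ind (inImage ρ j) * 1)   ≡⟨ sym (∑-image ρ inj (λ _ → 1)) ⟩
  ∑[ i < k ] 1                         ≡⟨ ∑-const k 1 ⟩
  k * 1                                ≡⟨ *-identityʳ k ⟩
  k                                    ∎
  where open ≡-Reasoning

size-full : ∀ {n} (sel : Sel n) → size sel ≡ n → ∀ j → T (sel j)
size-full {suc n} sel full j with sel zero in eq
size-full {suc n} sel full zero | true = subst T (sym eq) tt
size-full {suc n} sel full (suc j) | true = size-full (sel ∘ suc) (suc-injective full) j
... | false = ⊥-elim (<-irrefl full (s≤s (size-≤ (sel ∘ suc))))

∑-permute : ∀ k (π : Fin k → Fin k) → Injective π → (f : Fin k → ℕ) →
  ∑[ i < k ] f (π i) ≡ ∑[ i < k ] f i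
∑-permute k π inj f = trans (∑-image π inj f) (sum-cong-≗ (λ j →
  trans (cong (_* f j) (T⇒ind≡1 (size-full (inImage π) (size-image π inj) j))) (+-identityʳ (f j))))

card : ∀ {m} → Vec Bool m → ℕ
card M = size (V.lookup M)

imageMask : ∀ {k m} → (Fin k → Fin m) → Vec Bool m
imageMask ρ = V.tabulate (inImage ρ)

card-imageMask : ∀ {k m} (ρ : Fin k → Fin m) → Injective ρ → card (imageMask ρ) ≡ k
card-imageMask ρ inj =
  trans (sum-cong-≗ (λ j → cong ind (VP.lookup∘tabulate (inImage ρ) j))) (size-image ρ inj)

mask-eq : ∀ {m} (M N : Vec Bool m) → (∀ j → T (V.lookup M j) → T (V.lookup N j)) → card M ≡ card N → M ≡ N
mask-eq [] [] _ _ = refl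
mask-eq (true ∷ M) (true ∷ N) M⊆N e = cong (true ∷_) (mask-eq M N (M⊆N ∘ suc) (suc-injective e))
mask-eq (true ∷ M) (false ∷ N) M⊆N e = ⊥-elim (M⊆N zero tt)
mask-eq (false ∷ M) (false ∷ N) M⊆N e = cong (false ∷_) (mask-eq M N (M⊆N ∘ suc) e)
mask-eq (false ∷ M) (true ∷ N) M⊆N e =
  ⊥-elim (<-irrefl e (s≤s (size-mono (V.lookup M) (V.lookup N) (M⊆N ∘ suc))))

masks : (m k : ℕ) → List (Vec Bool m)
masks zero zero = [] ∷ []
masks zero (suc k) = []
masks (suc m) zero = L.map (false ∷_) (masks m zero)
masks (suc m) (suc k) = L.map (true ∷_) (masks m k) ++ L.map (false ∷_) (masks m (suc k))

masks-length : ∀ m k → L.length (masks m k) ≡ m C k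
masks-length zero zero = refl
masks-length zero (suc k) = refl
masks-length (suc m) zero = trans (LP.length-map _ (masks m zero)) (masks-length m zero)
masks-length (suc m) (suc k) = begin
  L.length (L.map (true ∷_) (masks m k) ++ L.map (false ∷_) (masks m (suc k)))
    ≡⟨ LP.length-++ (L.map (true ∷_) (masks m k)) ⟩
  L.length (L.map (true ∷_) (masks m k)) + L.length (L.map (false ∷_) (masks m (suc k)))
    ≡⟨ cong₂ _+_ (trans (LP.length-map _ (masks m k)) (masks-length m k))
                 (trans (LP.length-map _ (masks m (suc k))) (masks-length m (suc k))) ⟩
  m C k + m C suc k
    ≡⟨ nCk+nC[k+1]≡[n+1]C[k+1] m k ⟩
  suc m C suc k ∎
  where open ≡-Reasoning

masks-complete : ∀ {m} (M : Vec Bool m) → M ∈ masks m (card M)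
masks-complete [] = here refl
masks-complete (true ∷ M) = ∈-++⁺ˡ (∈-map⁺ (true ∷_) (masks-complete M))
masks-complete {suc m} (false ∷ M) with card M | masks-complete M
... | zero | M∈ = ∈-map⁺ (false ∷_) M∈
... | suc c | M∈ = ∈-++⁺ʳ (L.map (true ∷_) (masks m c)) (∈-map⁺ (false ∷_) M∈)

masks-sound : ∀ m k {M} → M ∈ masks m k → card M ≡ k
masks-sound zero zero (here refl) = refl
masks-sound (suc m) zero M∈ with ∈-map⁻ (false ∷_) M∈
... | M , M∈′ , refl = masks-sound m zero M∈′
masks-sound (suc m) (suc k) M∈ with ∈-++⁻ (L.map (true ∷_) (masks m k)) M∈
... | inj₁ M∈ˡ with ∈-map⁻ (true ∷_) M∈ˡ
...   | M , M∈′ , refl = cong suc (masks-sound m k M∈′)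
masks-sound (suc m) (suc k) M∈ | inj₂ M∈ʳ with ∈-map⁻ (false ∷_) M∈ʳ
...   | M , M∈′ , refl = masks-sound m (suc k) M∈′

masks-unique : ∀ m k → Unique (masks m k)
masks-unique zero zero = [] ∷ []
masks-unique zero (suc k) = []
masks-unique (suc m) zero = UP.map⁺ VP.∷-injectiveʳ (masks-unique m zero)
masks-unique (suc m) (suc k) =
  UP.++⁺ (UP.map⁺ VP.∷-injectiveʳ (masks-unique m k)) (UP.map⁺ VP.∷-injectiveʳ (masks-unique m (suc k))) disjoint
  where
  disjoint : ∀ {M} → M ∈ L.map (true ∷_) (masks m k) × M ∈ L.map (false ∷_) (masks m (suc k)) → ⊥
  disjoint (M∈ˡ , M∈ʳ) with ∈-map⁻ (true ∷_) M∈ˡ | ∈-map⁻ (false ∷_) M∈ʳ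
  ... | _ , _ , refl | _ , _ , ()

enum : ∀ {m} (M : Vec Bool m) → Fin (card M) → Fin m
enum (true ∷ M) zero = zero
enum (true ∷ M) (suc i) = suc (enum M i)
enum (false ∷ M) i = suc (enum M i)

enum-injective : ∀ {m} (M : Vec Bool m) → Injective (enum M)
enum-injective (true ∷ M) zero zero e = refl
enum-injective (true ∷ M) (suc x) (suc y) e = cong suc (enum-injective M x y (FP.suc-injective e))
enum-injective (false ∷ M) x y e = enum-injective M x y (FP.suc-injective e)

enum-in : ∀ {m} (M : Vec Bool m) i → T (V.lookup M (enum M i))
enum-in (true ∷ M) zero = tt
enum-in (true ∷ M) (suc i) = enum-in M i
enum-in (false ∷ M) i = enum-in M i

enum-onto : ∀ {m} (M : Vec Bool m) j → T (V.lookup M j) → ∃ λ i → enum M i ≡ j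
enum-onto (true ∷ M) zero t = zero , refl
enum-onto (true ∷ M) (suc j) t = let i , e = enum-onto M j t in suc i , cong suc e
enum-onto (false ∷ M) (suc j) t = let i , e = enum-onto M j t in i , cong suc e

lookup-ext : ∀ {A : Set} {n} (v w : Vec A n) → (∀ i → V.lookup v i ≡ V.lookup w i) → v ≡ w
lookup-ext v w e = trans (sym (VP.tabulate∘lookup v)) (trans (VP.tabulate-cong e) (VP.tabulate∘lookup w))

unique-lookup : ∀ {A : Set} {xs : List A} → Unique xs → ∀ i j → L.lookup xs i ≡ L.lookup xs j → i ≡ j
unique-lookup (_ ∷ _) zero zero e = refl
unique-lookup (x∉ ∷ _) zero (suc j) e = ⊥-elim (All.lookup x∉ (∈-lookup j) e)
unique-lookup (x∉ ∷ _) (suc i) zero e = ⊥-elim (All.lookup x∉ (∈-lookup i) (sym e))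
unique-lookup (_ ∷ u) (suc i) (suc j) e = cong suc (unique-lookup u i j e)

ones-∑ : ∀ {k} (v : Vec (Fin 2) k) → ones v ≡ ∑[ i < k ] toℕ (V.lookup v i)
ones-∑ [] = refl
ones-∑ (x ∷ v) = cong (toℕ x +_) (ones-∑ v)

allCols-complete : ∀ {k} (v : Vec (Fin 2) k) → v ∈ allCols k
allCols-complete [] = here refl
allCols-complete {suc k} (zero ∷ v) = ∈-++⁺ˡ (∈-map⁺ (zero ∷_) (allCols-complete v))
allCols-complete {suc k} (suc zero ∷ v) =
  ∈-++⁺ʳ (L.map (zero ∷_) (allCols k)) (∈-map⁺ (suc zero ∷_) (allCols-complete v))

allCols-unique : ∀ k → Unique (allCols k)
allCols-unique zero = [] ∷ []
allCols-unique (suc k) =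
  UP.++⁺ (UP.map⁺ VP.∷-injectiveʳ (allCols-unique k)) (UP.map⁺ VP.∷-injectiveʳ (allCols-unique k)) disjoint
  where
  disjoint : ∀ {v} → v ∈ L.map (zero ∷_) (allCols k) × v ∈ L.map (suc zero ∷_) (allCols k) → ⊥
  disjoint (v∈ˡ , v∈ʳ) with ∈-map⁻ (zero ∷_) v∈ˡ | ∈-map⁻ (suc zero ∷_) v∈ʳ
  ... | _ , _ , refl | _ , _ , ()

K-unique : ∀ k s → Unique (K k s)
K-unique k s = UP.filter⁺ (λ v → ones v Data.Nat.≟ s) (allCols-unique k)
  where import Data.Nat

∈K : ∀ {k s} (v : Vec (Fin 2) k) → ones v ≡ s → v ∈ K k s
∈K {k} {s} v e = ∈-filter⁺ (λ v → ones v Data.Nat.≟ s) (allCols-complete v) e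
  where import Data.Nat

K⇒ones : ∀ {k s} {v : Vec (Fin 2) k} → v ∈ K k s → ones v ≡ s
K⇒ones {k} {s} v∈ = proj₂ (∈-filter⁻ (λ v → ones v Data.Nat.≟ s) {xs = allCols k} v∈)
  where import Data.Nat

_==ᵥ_ : ∀ {k} → Vec (Fin 2) k → Vec (Fin 2) k → Bool
v ==ᵥ w = does (VP.≡-dec FP._≟_ v w)

occ : ∀ {k} → Vec (Fin 2) k → List (Vec (Fin 2) k) → ℕ
occ v [] = 0
occ v (w ∷ F) = ind (v ==ᵥ w) + occ v F

==ᵥ⇒≡ : ∀ {k} (v w : Vec (Fin 2) k) → T (v ==ᵥ w) → v ≡ w
==ᵥ⇒≡ v w = does⇒ (VP.≡-dec FP._≟_ v w)

occ-size : ∀ {k} (v : Vec (Fin 2) k) F → size (λ j → v ==ᵥ L.lookup F j) ≡ occ v F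
occ-size v [] = refl
occ-size v (w ∷ F) = cong (ind (v ==ᵥ w) +_) (occ-size v F)

occ-· : ∀ {k} (v : Vec (Fin 2) k) p F → occ v (p · F) ≡ p * occ v F
occ-· v p [] = sym (*-zeroʳ p)
occ-· v p (w ∷ F) = begin
  occ v (L.replicate p w ++ p · F)             ≡⟨ occ-++ (L.replicate p w) ⟩
  occ v (L.replicate p w) + occ v (p · F)      ≡⟨ cong₂ _+_ (occ-replicate p) (occ-· v p F) ⟩
  p * ind (v ==ᵥ w) + p * occ v F              ≡⟨ sym (*-distribˡ-+ p (ind (v ==ᵥ w)) (occ v F)) ⟩
  p * (ind (v ==ᵥ w) + occ v F)                ∎
  where
  open ≡-Reasoning
  occ-++ : ∀ xs {ys} → occ v (xs ++ ys) ≡ occ v xs + occ v ys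
  occ-++ [] = refl
  occ-++ (x ∷ xs) = trans (cong (ind (v ==ᵥ x) +_) (occ-++ xs)) (sym (+-assoc (ind (v ==ᵥ x)) _ _))
  occ-replicate : ∀ q → occ v (L.replicate q w) ≡ q * ind (v ==ᵥ w)
  occ-replicate zero = refl
  occ-replicate (suc q) = cong (ind (v ==ᵥ w) +_) (occ-replicate q)

∈⇒occ : ∀ {k} {v : Vec (Fin 2) k} {F} → v ∈ F → 1 ≤ occ v F
∈⇒occ {v = v} {w ∷ F} (here refl) with VP.≡-dec FP._≟_ v v
... | yes _ = s≤s z≤n
... | no v≢v = ⊥-elim (v≢v refl)
∈⇒occ {v = v} {w ∷ F} (there v∈) = ≤-trans (∈⇒occ v∈) (m≤n+m _ (ind (v ==ᵥ w)))

occ⇒∈ : ∀ {k} (v : Vec (Fin 2) k) F → 1 ≤ occ v F → v ∈ F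
occ⇒∈ v (w ∷ F) pos with VP.≡-dec FP._≟_ v w
... | yes v≡w = here v≡w
... | no _ = there (occ⇒∈ v F pos)

occ-unique : ∀ {k} (v : Vec (Fin 2) k) F → Unique F → occ v F ≤ 1
occ-unique v [] _ = z≤n
occ-unique v (w ∷ F) (w∉ ∷ u) with VP.≡-dec FP._≟_ v w
... | yes refl = ≤-reflexive (cong suc (n≤0⇒n≡0 (≮⇒≥ (λ pos → All.lookup w∉ (occ⇒∈ v F pos) refl))))
... | no _ = occ-unique v F u

cast-injective : ∀ {m n} .(e : m ≡ n) (x y : Fin m) → F.cast e x ≡ F.cast e y → x ≡ y
cast-injective e x y eq = FP.toℕ-injective (trans (sym (FP.toℕ-cast e x)) (trans (cong toℕ eq) (FP.toℕ-cast e y)))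

listMatrix : ∀ {m N r} (cols : List (Vec (Fin r) m)) → L.length cols ≡ N → Matrix m N r
listMatrix cols e i j = V.lookup (L.lookup cols (F.cast (sym e) j)) i

listMatrix-simple : ∀ {m N r} (cols : List (Vec (Fin r) m)) (e : L.length cols ≡ N) →
  Unique cols → Simple (listMatrix cols e)
listMatrix-simple cols e u j j′ same = cast-injective (sym e) j j′
  (unique-lookup u _ _ (lookup-ext _ _ same))

term : ℕ → ℕ → ℕ → ℕ
term q m i = (m C i) * q ^ (m ∸ i)

sum-applyUpTo : ∀ (f : ℕ → ℕ) k → ListAction.sum (L.applyUpTo f k) ≡ ∑[ i < k ] f (toℕ i)
sum-applyUpTo f zero = refl
sum-applyUpTo f (suc k) = cong (f 0 +_) (sum-applyUpTo (f ∘ suc) k)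

bound-∑ : ∀ m r k → bound m r k ≡ ∑[ i < k ] term (r ∸ 1) m (toℕ i)
bound-∑ m r k = trans (cong ListAction.sum (LP.map-upTo (term (r ∸ 1) m) k)) (sum-applyUpTo _ k)

bound-noRows : ∀ r k → bound 0 r (suc k) ≡ 1
bound-noRows r k = trans (bound-∑ 0 r (suc k))
  (cong suc (∑-zero {k} _ (λ i → cong (_* 1) (k>n⇒nCk≡0 {0} {suc (toℕ i)} (s≤s z≤n)))))

term-0 : ∀ q m → term q (suc m) 0 ≡ q * term q m 0
term-0 q m = trans (+-identityʳ (q * q ^ m)) (cong (q *_) (sym (+-identityʳ (q ^ m))))

term-suc : ∀ q m i → term q (suc m) (suc i) ≡ term q m i + q * term q m (suc i)
term-suc q m i = begin
  (suc m C suc i) * q ^ (m ∸ i)          ≡⟨ cong (_* q ^ (m ∸ i)) (sym (nCk+nC[k+1]≡[n+1]C[k+1] m i)) ⟩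
  (m C i + m C suc i) * q ^ (m ∸ i)      ≡⟨ *-distribʳ-+ (q ^ (m ∸ i)) (m C i) (m C suc i) ⟩
  term q m i + (m C suc i) * q ^ (m ∸ i) ≡⟨ cong (term q m i +_) (shift (suc i ≤? m)) ⟩
  term q m i + q * term q m (suc i)      ∎
  where
  open ≡-Reasoning
  shift : Dec (suc i ≤ m) → (m C suc i) * q ^ (m ∸ i) ≡ q * term q m (suc i)
  shift (yes i<m) rewrite +-∸-assoc 1 i<m = x*[y*z]≡y*[x*z] (m C suc i) q (q ^ (m ∸ suc i))
    where
    x*[y*z]≡y*[x*z] : ∀ x y z → x * (y * z) ≡ y * (x * z)
    x*[y*z]≡y*[x*z] x y z = trans (sym (*-assoc x y z)) (trans (cong (_* z) (*-comm x y)) (*-assoc y x z))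
  shift (no i≮m) rewrite k>n⇒nCk≡0 {m} {suc i} (≰⇒> i≮m) = sym (*-zeroʳ q)

bound-rec : ∀ m r k → bound (suc m) r (suc k) ≡ (r ∸ 1) * bound m r (suc k) + bound m r k
bound-rec m r k = begin
  bound (suc m) r (suc k)
    ≡⟨ bound-∑ (suc m) r (suc k) ⟩
  term q (suc m) 0 + ∑[ i < k ] term q (suc m) (suc (toℕ i))
    ≡⟨ cong₂ _+_ (term-0 q m) (sum-cong-≗ {k} (λ i → term-suc q m (toℕ i))) ⟩
  q * t₀ + ∑[ i < k ] (term q m (toℕ i) + q * term q m (suc (toℕ i)))
    ≡⟨ cong (q * t₀ +_) (∑-distrib-+ {k} (λ i → term q m (toℕ i)) (λ i → q * term q m (suc (toℕ i)))) ⟩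
  q * t₀ + (S + ∑[ i < k ] (q * term q m (suc (toℕ i))))
    ≡⟨ cong (λ x → q * t₀ + (S + x)) (sym (*-distribˡ-sum {k} q (λ i → term q m (suc (toℕ i))))) ⟩
  q * t₀ + (S + q * S′)
    ≡⟨ cong (q * t₀ +_) (+-comm S (q * S′)) ⟩
  q * t₀ + (q * S′ + S)
    ≡⟨ sym (+-assoc (q * t₀) (q * S′) S) ⟩
  (q * t₀ + q * S′) + S
    ≡⟨ cong (_+ S) (sym (*-distribˡ-+ q t₀ S′)) ⟩
  q * (t₀ + S′) + S
    ≡⟨ sym (cong₂ (λ x y → q * x + y) (bound-∑ m r (suc k)) (bound-∑ m r k)) ⟩
  q * bound m r (suc k) + bound m r k ∎
  where
  open ≡-Reasoning
  q = r ∸ 1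
  t₀ = term q m 0
  S = ∑[ i < k ] term q m (toℕ i)
  S′ = ∑[ i < k ] term q m (suc (toℕ i))

Match : ∀ {m n r k} → Matrix m n r → (Fin k → Fin m) → Fin n → Vec (Fin 2) k → Set
Match A ρ j v = ∀ i → toℕ (A (ρ i) j) ≡ toℕ (V.lookup v i)

SimpleOn : ∀ {m n r} → Matrix m n r → Sel n → Set
SimpleOn A sel = ∀ j j′ → T (sel j) → T (sel j′) → (∀ i → A i j ≡ A i j′) → j ≡ j′

AvoidsOn : ∀ {m n r k} → Matrix m n r → Sel n → List (Vec (Fin 2) k) → Set
AvoidsOn {m} {n} {k = k} A sel P = (ρ : Fin k → Fin m) → Injective ρ →
  ((v : Vec (Fin 2) k) → v ∈ P → Σ (Fin n) λ j → T (sel j) × Match A ρ j v) → ⊥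

-- A matrix avoiding K k s avoids it on every selection: since K k s has no
-- repetitions, the matching columns are automatically distinct.
Avoids⇒AvoidsOn : ∀ {m n r k s} (A : Matrix m n r) (sel : Sel n) → Avoids A (K k s) → AvoidsOn A sel (K k s)
Avoids⇒AvoidsOn {n = n} {k = k} {s} A sel avoids ρ inj matched = avoids (ρ , γ , inj , γ-injective , γ-match)
  where
  γ : Fin (L.length (K k s)) → Fin n
  γ j = proj₁ (matched (L.lookup (K k s) j) (∈-lookup j))
  γ-match : ∀ i j → toℕ (A (ρ i) (γ j)) ≡ toℕ (V.lookup (L.lookup (K k s) j) i)
  γ-match i j = proj₂ (proj₂ (matched (L.lookup (K k s) j) (∈-lookup j))) i
  γ-injective : Injective γ
  γ-injective x y e = unique-lookup (K-unique k s) x y (lookup-ext _ _ (λ i → FP.toℕ-injective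
    (trans (sym (γ-match i x)) (trans (cong (λ c → toℕ (A (ρ i) c)) e) (γ-match i y)))))

AvoidsOn-rest : ∀ {m n r k} (A : Matrix (suc m) n r) (sel sel′ : Sel n) (P : List (Vec (Fin 2) k)) →
  (∀ j → T (sel′ j) → T (sel j)) → AvoidsOn A sel P → AvoidsOn (A ∘ suc) sel′ P
AvoidsOn-rest A sel sel′ P sel′⊆sel avoids ρ inj matched =
  avoids (suc ∘ ρ) (λ x y e → inj x y (FP.suc-injective e))
    (λ v v∈ → let j , s , match = matched v v∈ in j , sel′⊆sel j s , match)

extendRows : ∀ {k m} → (Fin k → Fin m) → Fin (suc k) → Fin (suc m)
extendRows ρ zero = zero
extendRows ρ (suc i) = suc (ρ i)

extendRows-injective : ∀ {k m} (ρ : Fin k → Fin m) → Injective ρ → Injective (extendRows ρ)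
extendRows-injective ρ inj zero zero e = refl
extendRows-injective ρ inj (suc x) (suc y) e = cong suc (inj x y (FP.suc-injective e))

-- Selected columns are split into: those with
-- top entry 0 or 1 whose lower part does not repeat ("kept", pairwise distinct below
-- the first row), those with top entry 1 whose lower part repeats that of a column with
-- top entry 0 ("doubled"; these avoid the tails of P), and those with a larger top entry.
module Shift {r′ m n : ℕ} (A : Matrix (suc m) n (2 + r′)) (sel : Sel n) where
  top : Fin n → Fin (2 + r′)
  top = A zero

  rest : Matrix m n (2 + r′)
  rest = A ∘ suc

  Shadowed : Fin n → Set
  Shadowed j = ∃ λ j′ → T (sel j′) × top j′ ≡ zero × (∀ i → rest i j′ ≡ rest i j)

  shadowed? : ∀ j → Dec (Shadowed j)
  shadowed? j =
    FP.any? (λ j′ → T? (sel j′) ×-dec ((top j′ FP.≟ zero) ×-dec FP.all? (λ i → rest i j′ FP.≟ rest i j)))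
    where open import Data.Bool.Properties using (T?)

  withTop : Fin (2 + r′) → Sel n
  withTop a j = sel j ∧ (top j == a)

  kept : Sel n
  kept j = sel j ∧ ((top j == zero) ∨ ((top j == suc zero) ∧ not (does (shadowed? j))))

  doubled : Sel n
  doubled j = sel j ∧ ((top j == suc zero) ∧ does (shadowed? j))

  kept-cases : ∀ j → T (kept j) → T (sel j) × (top j ≡ zero ⊎ (top j ≡ suc zero × ¬ Shadowed j))
  kept-cases j t with to T-∧ t
  ... | s , t′ with to (T-∨ {top j == zero}) t′
  ... | inj₁ t₀ = s , inj₁ (==⇒≡ _ _ t₀)
  ... | inj₂ t₁ = let t₁′ , ¬sh = to T-∧ t₁ in s , inj₂ (==⇒≡ _ _ t₁′ , not-does⇒ (shadowed? j) ¬sh)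

  doubled-cases : ∀ j → T (doubled j) → T (sel j) × top j ≡ suc zero × Shadowed j
  doubled-cases j t with to T-∧ t
  ... | s , t′ = let t₁ , sh = to T-∧ t′ in s , ==⇒≡ _ _ t₁ , does⇒ (shadowed? j) sh

  columns-equal : ∀ j j′ → top j ≡ top j′ → (∀ i → rest i j ≡ rest i j′) → ∀ i → A i j ≡ A i j′
  columns-equal j j′ e₀ e zero = e₀
  columns-equal j j′ e₀ e (suc i) = e i

  simple-withTop : SimpleOn A sel → ∀ a → SimpleOn rest (withTop a)
  simple-withTop simple a j j′ t t′ e with to T-∧ t | to T-∧ t′
  ... | s , a≡ | s′ , a≡′ =
    simple j j′ s s′ (columns-equal j j′ (trans (==⇒≡ _ _ a≡) (sym (==⇒≡ _ _ a≡′))) e)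

  simple-kept : SimpleOn A sel → SimpleOn rest kept
  simple-kept simple j j′ t t′ e with kept-cases j t | kept-cases j′ t′
  ... | s , inj₁ t₀ | s′ , inj₁ t₀′ = simple j j′ s s′ (columns-equal j j′ (trans t₀ (sym t₀′)) e)
  ... | s , inj₂ (t₁ , _) | s′ , inj₂ (t₁′ , _) = simple j j′ s s′ (columns-equal j j′ (trans t₁ (sym t₁′)) e)
  ... | s , inj₁ t₀ | s′ , inj₂ (_ , ¬sh′) = ⊥-elim (¬sh′ (j , s , t₀ , e))
  ... | s , inj₂ (_ , ¬sh) | s′ , inj₁ t₀′ = ⊥-elim (¬sh (j′ , s′ , t₀′ , (λ i → sym (e i))))

  simple-doubled : SimpleOn A sel → SimpleOn rest doubled
  simple-doubled simple j j′ t t′ e with doubled-cases j t | doubled-cases j′ t′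
  ... | s , t₁ , _ | s′ , t₁′ , _ = simple j j′ s s′ (columns-equal j j′ (trans t₁ (sym t₁′)) e)

  -- A copy of the tails of P in the doubled columns extends, through the first row, to a
  -- copy of P: a column of P starting with 0 is matched by the shadowing column.
  avoids-doubled : ∀ {k} (P : List (Vec (Fin 2) (suc k))) → AvoidsOn A sel P → AvoidsOn rest doubled (L.map V.tail P)
  avoids-doubled P avoids ρ inj matched = avoids (extendRows ρ) (extendRows-injective ρ inj) matched⁺
    where
    matched⁺ : ∀ v → v ∈ P → Σ (Fin n) λ j → T (sel j) × Match A (extendRows ρ) j v
    matched⁺ (b ∷ u) v∈ with matched u (∈-map⁺ V.tail v∈)
    ... | j , t , match with doubled-cases j t
    ... | s , t₁ , (j′ , s′ , t₀ , same) with b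
    ... | zero = j′ , s′ , match₀
      where
      match₀ : Match A (extendRows ρ) j′ (zero ∷ u)
      match₀ zero = cong toℕ t₀
      match₀ (suc i) = trans (cong toℕ (same (ρ i))) (match i)
    ... | suc zero = j , s , match₁
      where
      match₁ : Match A (extendRows ρ) j (suc zero ∷ u)
      match₁ zero = cong toℕ t₁
      match₁ (suc i) = match i

  size-kept-doubled : size (withTop zero) + size (withTop (suc zero)) ≡ size kept + size doubled
  size-kept-doubled = trans (sym (∑-distrib-+ (ind ∘ withTop zero) (ind ∘ withTop (suc zero))))
    (trans (sum-cong-≗ (λ j → regroup (sel j) (top j == zero) (top j == suc zero) (does (shadowed? j)) (exclusive (top j))))
      (∑-distrib-+ (ind ∘ kept) (ind ∘ doubled)))
    where
    exclusive : ∀ (x : Fin (2 + r′)) → (x == zero) ∧ (x == suc zero) ≡ false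
    exclusive zero = refl
    exclusive (suc zero) = refl
    exclusive (suc (suc x)) = refl
    regroup : ∀ s b₀ b₁ d → b₀ ∧ b₁ ≡ false →
      ind (s ∧ b₀) + ind (s ∧ b₁) ≡ ind (s ∧ (b₀ ∨ (b₁ ∧ not d))) + ind (s ∧ (b₁ ∧ d))
    regroup false b₀ b₁ d _ = refl
    regroup true true false d _ = refl
    regroup true false true true _ = refl
    regroup true false true false _ = refl
    regroup true false false d _ = refl

shifting-bound : ∀ {r′} m k {n} (A : Matrix m n (2 + r′)) (sel : Sel n) (P : List (Vec (Fin 2) k)) →
  SimpleOn A sel → AvoidsOn A sel P → size sel ≤ bound m (2 + r′) k
shifting-bound m zero A sel P simple avoids =
  ≤-reflexive (size-none sel (λ j t → avoids (λ ()) (λ ()) (λ _ _ → j , t , λ ())))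
shifting-bound {r′} zero (suc k) A sel P simple avoids =
  subst (size sel ≤_) (sym (bound-noRows (2 + r′) k)) (size-atMostOne sel (λ j j′ t t′ → simple j j′ t t′ (λ ())))
shifting-bound {r′} (suc m) (suc k) {n} A sel P simple avoids =
  subst (size sel ≤_) (sym (bound-rec m (2 + r′) k)) (begin
    size sel                          ≡⟨ size-partition (2 + r′) sel top ⟩
    S₀ + (S₁ + Sᵣ)                     ≡⟨ sym (+-assoc S₀ S₁ Sᵣ) ⟩
    (S₀ + S₁) + Sᵣ                     ≡⟨ cong (_+ Sᵣ) size-kept-doubled ⟩
    (size kept + size doubled) + Sᵣ    ≤⟨ +-mono-≤ (+-mono-≤ kept-bound doubled-bound) others-bound ⟩
    (B + B′) + r′ * B                  ≡⟨ +-assoc B B′ (r′ * B) ⟩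
    B + (B′ + r′ * B)                  ≡⟨ cong (B +_) (+-comm B′ (r′ * B)) ⟩
    B + (r′ * B + B′)                  ≡⟨ sym (+-assoc B (r′ * B) B′) ⟩
    suc r′ * B + B′                    ∎)
  where
  open Shift A sel
  open ≤-Reasoning
  B = bound m (2 + r′) (suc k)
  B′ = bound m (2 + r′) k
  S₀ = size (withTop zero)
  S₁ = size (withTop (suc zero))
  Sᵣ = ∑[ a < r′ ] size (withTop (suc (suc a)))
  withTop-bound : ∀ a → size (withTop a) ≤ B
  withTop-bound a = shifting-bound m (suc k) rest (withTop a) P (simple-withTop simple a)
    (AvoidsOn-rest A sel (withTop a) P (λ j t → proj₁ (to T-∧ t)) avoids)
  kept-bound : size kept ≤ B
  kept-bound = shifting-bound m (suc k) rest kept P (simple-kept simple)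
    (AvoidsOn-rest A sel kept P (λ j t → proj₁ (to T-∧ t)) avoids)
  doubled-bound : size doubled ≤ B′
  doubled-bound = shifting-bound m k rest doubled (L.map V.tail P) (simple-doubled simple) (avoids-doubled P avoids)
  others-bound : Sᵣ ≤ r′ * B
  others-bound = ≤-trans (∑-mono {r′} (λ a → size (withTop (suc (suc a)))) (λ _ → B) (λ a → withTop-bound (suc (suc a))))
    (≤-reflexive (∑-const r′ B))

forb-K-upper : ∀ {r′} m k s {n} (A : Matrix m n (2 + r′)) → Simple A → Avoids A (K k s) → n ≤ bound m (2 + r′) k
forb-K-upper {r′} m k s {n} A simple avoids = subst (_≤ bound m (2 + r′) k) (size-all n)
  (shifting-bound m k A (λ _ → true) (K k s) (λ j j′ _ _ → simple j j′) (Avoids⇒AvoidsOn A _ avoids))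

length-cartesianProductWith : ∀ {A B C : Set} (f : A → B → C) xs ys →
  L.length (L.cartesianProductWith f xs ys) ≡ L.length xs * L.length ys
length-cartesianProductWith f [] ys = refl
length-cartesianProductWith f (x ∷ xs) ys =
  trans (LP.length-++ (L.map (f x) ys)) (cong₂ _+_ (LP.length-map (f x) ys) (length-cartesianProductWith f xs ys))

bit : ∀ {r′} → Bool → Fin (2 + r′)
bit true = suc zero
bit false = zero

toℕ-bit : ∀ {r′} b → toℕ (bit {r′} b) ≡ ind b
toℕ-bit true = refl
toℕ-bit false = refl

-- The extremal construction of part one, for r = 2 + r′ and the threshold t = k ∸ s.
-- A column is read from the top while counting "marks": an entry is a mark if it equals
-- the expected symbol, which is 0 as long as fewer than t marks have been seen and 1
-- afterwards.
module Marking (r′ t : ℕ) where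
  expected : ℕ → Fin (2 + r′)
  expected c = bit (t ≤ᵇ c)

  marks : ∀ {m} → ℕ → Vec (Fin (2 + r′)) m → ℕ
  marks c [] = c
  marks c (a ∷ x) = marks (ind (a == expected c) + c) x

  others : ℕ → List (Fin (2 + r′))
  others c = L.map (punchIn (expected c)) (L.allFin (suc r′))

  others-length : ∀ c → L.length (others c) ≡ suc r′
  others-length c = trans (LP.length-map _ (L.allFin (suc r′))) (LP.length-tabulate (λ i → i))

  others-unique : ∀ c → Unique (others c)
  others-unique c = UP.map⁺ (λ {x} {y} → FP.punchIn-injective (expected c) x y) (UP.allFin⁺ (suc r′))

  others≢expected : ∀ c {a} → a ∈ others c → a ≢ expected c
  others≢expected c a∈ with ∈-map⁻ (punchIn (expected c)) a∈
  ... | b , _ , refl = FP.punchInᵢ≢i (expected c) b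

  fewMarks : (m : ℕ) → ℕ → ℕ → List (Vec (Fin (2 + r′)) m)
  fewMarks m c zero = []
  fewMarks zero c (suc j) = [] ∷ []
  fewMarks (suc m) c (suc j) =
    L.map (expected c ∷_) (fewMarks m (suc c) j) ++ L.cartesianProductWith _∷_ (others c) (fewMarks m c (suc j))

  fewMarks-length : ∀ m c j → L.length (fewMarks m c j) ≡ bound m (2 + r′) j
  fewMarks-length m c zero = refl
  fewMarks-length zero c (suc j) = sym (bound-noRows (2 + r′) j)
  fewMarks-length (suc m) c (suc j) = begin
    L.length (L.map (expected c ∷_) (fewMarks m (suc c) j) ++ L.cartesianProductWith _∷_ (others c) (fewMarks m c (suc j)))
      ≡⟨ LP.length-++ (L.map (expected c ∷_) (fewMarks m (suc c) j)) ⟩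
    L.length (L.map (expected c ∷_) (fewMarks m (suc c) j)) +
    L.length (L.cartesianProductWith _∷_ (others c) (fewMarks m c (suc j)))
      ≡⟨ cong₂ _+_ (trans (LP.length-map _ (fewMarks m (suc c) j)) (fewMarks-length m (suc c) j))
                   (trans (length-cartesianProductWith _∷_ (others c) (fewMarks m c (suc j)))
                          (cong₂ _*_ (others-length c) (fewMarks-length m c (suc j)))) ⟩
    bound m (2 + r′) j + suc r′ * bound m (2 + r′) (suc j)
      ≡⟨ +-comm (bound m (2 + r′) j) _ ⟩
    suc r′ * bound m (2 + r′) (suc j) + bound m (2 + r′) j
      ≡⟨ sym (bound-rec m (2 + r′) j) ⟩
    bound (suc m) (2 + r′) (suc j) ∎
    where open ≡-Reasoning

  fewMarks-unique : ∀ m c j → Unique (fewMarks m c j)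
  fewMarks-unique m c zero = []
  fewMarks-unique zero c (suc j) = [] ∷ []
  fewMarks-unique (suc m) c (suc j) = UP.++⁺ (UP.map⁺ VP.∷-injectiveʳ (fewMarks-unique m (suc c) j))
    (UP.cartesianProductWith⁺ _∷_ VP.∷-injective (others-unique c) (fewMarks-unique m c (suc j))) disjoint
    where
    disjoint : ∀ {x} → x ∈ L.map (expected c ∷_) (fewMarks m (suc c) j) ×
                       x ∈ L.cartesianProductWith _∷_ (others c) (fewMarks m c (suc j)) → ⊥
    disjoint (x∈ˡ , x∈ʳ) with ∈-map⁻ (expected c ∷_) x∈ˡ | ∈-cartesianProductWith⁻ _∷_ (others c) _ x∈ʳ
    ... | _ , _ , refl | a , _ , a∈ , _ , e = others≢expected c a∈ (sym (VP.∷-injectiveˡ e))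

  fewMarks-marks : ∀ m c j (x : Vec (Fin (2 + r′)) m) → x ∈ fewMarks m c j → marks c x < j + c
  fewMarks-marks zero c (suc j) [] _ = s≤s (m≤n+m c j)
  fewMarks-marks (suc m) c (suc j) x x∈
    with ∈-++⁻ (L.map (expected c ∷_) (fewMarks m (suc c) j)) x∈
  ... | inj₁ x∈ˡ with ∈-map⁻ (expected c ∷_) x∈ˡ
  ...   | y , y∈ , refl rewrite ind-==-refl (expected c) =
          subst (marks (suc c) y <_) (+-suc j c) (fewMarks-marks m (suc c) j y y∈)
  fewMarks-marks (suc m) c (suc j) x x∈ | inj₂ x∈ʳ with ∈-cartesianProductWith⁻ _∷_ (others c) _ x∈ʳ
  ...   | a , y , a∈ , y∈ , refl rewrite ind-==-≢ a (expected c) (others≢expected c a∈) =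
          fewMarks-marks m c (suc j) y y∈

  rowPattern : ∀ {m} → Vec Bool m → ℕ → Vec (Fin 2) m
  rowPattern [] d = []
  rowPattern (true ∷ M) d = bit (t ≤ᵇ d) ∷ rowPattern M (suc d)
  rowPattern (false ∷ M) d = zero ∷ rowPattern M d

  rowPattern-ones : ∀ {m} (M : Vec Bool m) d →
    ∑[ j < m ] (ind (V.lookup M j) * toℕ (V.lookup (rowPattern M d) j)) ≡ card M ∸ (t ∸ d)
  rowPattern-ones [] d = sym (0∸n≡0 (t ∸ d))
  rowPattern-ones (false ∷ M) d = rowPattern-ones M d
  rowPattern-ones (true ∷ M) d with t ≤ᵇ d in t≤ᵇd
  ... | true = begin
    suc (∑[ j < _ ] (ind (V.lookup M j) * toℕ (V.lookup (rowPattern M (suc d)) j)))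
      ≡⟨ cong suc (rowPattern-ones M (suc d)) ⟩
    suc (card M ∸ (t ∸ suc d))  ≡⟨ cong (λ x → suc (card M ∸ x)) (m≤n⇒m∸n≡0 (m≤n⇒m≤1+n t≤d)) ⟩
    suc (card M)                 ≡⟨ cong (suc (card M) ∸_) (sym (m≤n⇒m∸n≡0 t≤d)) ⟩
    suc (card M) ∸ (t ∸ d)       ∎
    where
    open ≡-Reasoning
    t≤d : t ≤ d
    t≤d = ≤ᵇ⇒≤ t d (subst T (sym t≤ᵇd) tt)
  ... | false = trans (rowPattern-ones M (suc d))
    (cong (suc (card M) ∸_) (sym (+-∸-assoc 1 {t} {suc d} (≰⇒> (λ t≤d → subst T t≤ᵇd (≤⇒≤ᵇ t≤d))))))

  mark-step : ∀ (a : Fin (2 + r′)) c d → d ≤ c → toℕ a ≡ ind (t ≤ᵇ d) → suc d ≤ ind (a == expected c) + c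
  mark-step a c d d≤c a≡ with t ≤ᵇ d in t≤ᵇd
  mark-step (suc zero) c d d≤c refl | true with t ≤ᵇ c in t≤ᵇc
  ... | true = s≤s d≤c
  ... | false = ⊥-elim (subst T t≤ᵇc (≤⇒≤ᵇ (≤-trans (≤ᵇ⇒≤ t d (subst T (sym t≤ᵇd) tt)) d≤c)))
  mark-step zero c d d≤c refl | false with t ≤ᵇ c in t≤ᵇc
  ... | false = s≤s d≤c
  ... | true = ≤-trans (≰⇒> (λ t≤d → subst T t≤ᵇd (≤⇒≤ᵇ t≤d))) (≤ᵇ⇒≤ t c (subst T (sym t≤ᵇc) tt))

  marks-pattern : ∀ {m} (x : Vec (Fin (2 + r′)) m) (M : Vec Bool m) c d → d ≤ c →
    (∀ j → T (V.lookup M j) → toℕ (V.lookup x j) ≡ toℕ (V.lookup (rowPattern M d) j)) → d + card M ≤ marks c x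
  marks-pattern [] [] c d d≤c _ = subst (_≤ c) (sym (+-identityʳ d)) d≤c
  marks-pattern (a ∷ x) (false ∷ M) c d d≤c agree =
    marks-pattern x M _ d (≤-trans d≤c (m≤n+m c _)) (agree ∘ suc)
  marks-pattern (a ∷ x) (true ∷ M) c d d≤c agree =
    subst (_≤ marks (ind (a == expected c) + c) x) (sym (+-suc d (card M)))
      (marks-pattern x M _ (suc d) (mark-step a c d d≤c (trans (agree zero tt) (toℕ-bit (t ≤ᵇ d)))) (agree ∘ suc))

  patternOf : ∀ {k m} → (Fin k → Fin m) → Vec (Fin 2) k
  patternOf ρ = V.tabulate (λ i → V.lookup (rowPattern (imageMask ρ) 0) (ρ i))

  patternOf-ones : ∀ {k m} (ρ : Fin k → Fin m) → Injective ρ → ones (patternOf ρ) ≡ k ∸ t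
  patternOf-ones {k} {m} ρ inj = begin
    ones (patternOf ρ)                                    ≡⟨ ones-∑ (patternOf ρ) ⟩
    ∑[ i < k ] toℕ (V.lookup (patternOf ρ) i)
      ≡⟨ sum-cong-≗ {k} (λ i → cong toℕ (VP.lookup∘tabulate _ i)) ⟩
    ∑[ i < k ] toℕ (V.lookup R (ρ i))                    ≡⟨ ∑-image ρ inj (λ j → toℕ (V.lookup R j)) ⟩
    ∑[ j < m ] (ind (inImage ρ j) * toℕ (V.lookup R j))
      ≡⟨ sum-cong-≗ (λ j → cong (λ b → ind b * toℕ (V.lookup R j)) (sym (VP.lookup∘tabulate (inImage ρ) j))) ⟩
    ∑[ j < m ] (ind (V.lookup (imageMask ρ) j) * toℕ (V.lookup R j)) ≡⟨ rowPattern-ones (imageMask ρ) 0 ⟩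
    card (imageMask ρ) ∸ t                                ≡⟨ cong (_∸ t) (card-imageMask ρ inj) ⟩
    k ∸ t                                                 ∎
    where
    open ≡-Reasoning
    R = rowPattern (imageMask ρ) 0

  marks-patternOf : ∀ {k m} (ρ : Fin k → Fin m) → Injective ρ → (x : Vec (Fin (2 + r′)) m) →
    (∀ i → toℕ (V.lookup x (ρ i)) ≡ toℕ (V.lookup (patternOf ρ) i)) → k ≤ marks 0 x
  marks-patternOf ρ inj x match = subst (_≤ marks 0 x) (card-imageMask ρ inj)
    (marks-pattern x (imageMask ρ) 0 0 z≤n agree)
    where
    agree : ∀ j → T (V.lookup (imageMask ρ) j) → toℕ (V.lookup x j) ≡ toℕ (V.lookup (rowPattern (imageMask ρ) 0) j)
    agree j t with inImage-elim ρ j (subst T (VP.lookup∘tabulate (inImage ρ) j) t)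
    ... | i , refl = trans (match i) (cong toℕ (VP.lookup∘tabulate _ i))

  patternOf∈K : ∀ {k m s} → t ≡ k ∸ s → s ≤ k → (ρ : Fin k → Fin m) → Injective ρ → patternOf ρ ∈ K k s
  patternOf∈K {k} refl s≤k ρ inj = ∈K (patternOf ρ) (trans (patternOf-ones ρ inj) (m∸[m∸n]≡n s≤k))

  fewMarks-mismatch : ∀ {k m} (ρ : Fin k → Fin m) → Injective ρ → ∀ x → x ∈ fewMarks m 0 k →
    ¬ (∀ i → toℕ (V.lookup x (ρ i)) ≡ toℕ (V.lookup (patternOf ρ) i))
  fewMarks-mismatch {k} {m} ρ inj x x∈ match = <-irrefl refl (≤-<-trans (marks-patternOf ρ inj x match)
    (subst (marks 0 x <_) (+-identityʳ k) (fewMarks-marks m 0 k x x∈)))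

index-of : ∀ {A : Set} {xs : List A} {x} → x ∈ xs → Σ (Fin (L.length xs)) λ j → L.lookup xs j ≡ x
index-of x∈ = Any.index x∈ , sym (AnyP.lookup-index x∈)

forb-K : ∀ r′ m k s → s ≤ k → IsForb m (2 + r′) (K k s) (bound m (2 + r′) k)
forb-K r′ m k s s≤k = (A , listMatrix-simple cols len (fewMarks-unique m 0 k) , avoids) ,
  (λ n A′ simple avoids′ → forb-K-upper m k s A′ simple avoids′)
  where
  open Marking r′ (k ∸ s)
  cols = fewMarks m 0 k
  len = fewMarks-length m 0 k
  A = listMatrix cols len
  avoids : Avoids A (K k s)
  avoids (ρ , γ , injρ , _ , match) with index-of (patternOf∈K refl s≤k ρ injρ)
  ... | j , Kj≡pattern = fewMarks-mismatch ρ injρ _ (∈-lookup _)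
    (λ i → trans (match i j) (cong (λ v → toℕ (V.lookup v i)) Kj≡pattern))

matches : ∀ {m n r k} → Matrix m n r → (Fin k → Fin m) → Fin n → Vec (Fin 2) k → Bool
matches A ρ j v = does (FP.all? (λ i → toℕ (A (ρ i) j) Data.Nat.≟ toℕ (V.lookup v i)))
  where import Data.Nat

matches⇒Match : ∀ {m n r k} (A : Matrix m n r) (ρ : Fin k → Fin m) j v → T (matches A ρ j v) → Match A ρ j v
matches⇒Match A ρ j v = does⇒ (FP.all? (λ i → toℕ (A (ρ i) j) Data.Nat.≟ toℕ (V.lookup v i)))
  where import Data.Nat

Match⇒matches : ∀ {m n r k} (A : Matrix m n r) (ρ : Fin k → Fin m) j v → Match A ρ j v → T (matches A ρ j v)
Match⇒matches A ρ j v = ⇒does (FP.all? (λ i → toℕ (A (ρ i) j) Data.Nat.≟ toℕ (V.lookup v i)))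
  where import Data.Nat

Match-unique : ∀ {m n r k} (A : Matrix m n r) (ρ : Fin k → Fin m) j v w → Match A ρ j v → Match A ρ j w → v ≡ w
Match-unique A ρ j v w match-v match-w = lookup-ext v w (λ i → FP.toℕ-injective (trans (sym (match-v i)) (match-w i)))

matching : ∀ {m n r k} → Matrix m n r → (Fin k → Fin m) → Sel n → Vec (Fin 2) k → Sel n
matching A ρ avail v j = avail j ∧ matches A ρ j v

use-column : ∀ {m n r k} (A : Matrix m n r) (ρ : Fin k → Fin m) (avail : Sel n) w F j₀ →
  T (matching A ρ avail w j₀) →
  (∀ v → occ v (w ∷ F) ≤ size (matching A ρ avail v)) →
  ∀ v → occ v F ≤ size (matching A ρ (λ j → avail j ∧ not (j₀ == j)) v)
use-column A ρ avail w F j₀ t₀ enough v = +-cancelʳ-≤ (ind (v ==ᵥ w)) (occ v F) _ (begin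
  occ v F + ind (v ==ᵥ w)                  ≡⟨ +-comm (occ v F) _ ⟩
  occ v (w ∷ F)                            ≤⟨ enough v ⟩
  size (matching A ρ avail v)              ≡⟨ size-remove (matching A ρ avail v) j₀ ⟩
  size (λ j → matching A ρ avail v j ∧ not (j₀ == j)) + ind (matching A ρ avail v j₀)
    ≡⟨ cong₂ _+_ (sum-cong-≗ (λ j → cong ind (regroup (avail j) (not (j₀ == j)) (matches A ρ j v)))) j₀-counts ⟩
  size (matching A ρ (λ j → avail j ∧ not (j₀ == j)) v) + ind (v ==ᵥ w) ∎)
  where
  open ≤-Reasoning
  j₀-counts : ind (matching A ρ avail v j₀) ≡ ind (v ==ᵥ w)
  j₀-counts with VP.≡-dec FP._≟_ v w
  ... | yes refl = T⇒ind≡1 t₀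
  ... | no v≢w = ¬T⇒ind≡0 (λ t → v≢w (Match-unique A ρ j₀ v w
          (matches⇒Match A ρ j₀ v (proj₂ (to T-∧ t))) (matches⇒Match A ρ j₀ w (proj₂ (to T-∧ t₀)))))
  regroup : ∀ a b c → (a ∧ c) ∧ b ≡ (a ∧ b) ∧ c
  regroup a b c = trans (∧-assoc a c b) (trans (cong (a ∧_) (∧-comm c b)) (sym (∧-assoc a b c)))

embed : ∀ {m n r k} (A : Matrix m n r) (ρ : Fin k → Fin m) (F : List (Vec (Fin 2) k)) (avail : Sel n) →
  (∀ v → occ v F ≤ size (matching A ρ avail v)) →
  Σ (Fin (L.length F) → Fin n) λ γ →
    Injective γ × (∀ q → T (avail (γ q))) × (∀ q → Match A ρ (γ q) (L.lookup F q))
embed A ρ [] avail enough = (λ ()) , (λ ()) , (λ ()) , (λ ())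
embed {n = n} A ρ (w ∷ F) avail enough
  with size-pos (matching A ρ avail w) (≤-trans (∈⇒occ {F = w ∷ F} (here refl)) (enough w))
... | j₀ , t₀ with embed A ρ F (λ j → avail j ∧ not (j₀ == j)) (use-column A ρ avail w F j₀ t₀ enough)
... | γ′ , γ′-injective , γ′-avail , γ′-match = γ , γ-injective , γ-avail , γ-match
  where
  γ : Fin (suc (L.length F)) → Fin n
  γ zero = j₀
  γ (suc q) = γ′ q
  γ′≢j₀ : ∀ q → γ′ q ≢ j₀
  γ′≢j₀ q e = let _ , fresh = to T-∧ (γ′-avail q) in not-does⇒ (j₀ FP.≟ γ′ q) fresh (sym e)
  γ-injective : Injective γ
  γ-injective zero zero e = refl
  γ-injective zero (suc y) e = ⊥-elim (γ′≢j₀ y (sym e))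
  γ-injective (suc x) zero e = ⊥-elim (γ′≢j₀ x e)
  γ-injective (suc x) (suc y) e = cong suc (γ′-injective x y e)
  γ-avail : ∀ q → T (avail (γ q))
  γ-avail zero = proj₁ (to T-∧ t₀)
  γ-avail (suc q) = proj₁ (to T-∧ (γ′-avail q))
  γ-match : ∀ q → Match A ρ (γ q) (L.lookup (w ∷ F) q)
  γ-match zero = matches⇒Match A ρ j₀ w (proj₂ (to T-∧ t₀))
  γ-match (suc q) = γ′-match q

module RareColumns {r′ m n k s p : ℕ} (A : Matrix m n (2 + r′)) (avoids : Avoids A (p · K k s)) where

  -- On any k rows, some column of K k s is matched by fewer than p columns of A:
  -- otherwise the greedy embedding produces a copy of p · K k s.
  rare : (ρ : Fin k → Fin m) → Injective ρ → Σ (Vec (Fin 2) k) λ v → v ∈ K k s × size (λ j → matches A ρ j v) < p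
  rare ρ inj with Any.any? (λ v → size (λ j → matches A ρ j v) <? p) (K k s)
  ... | yes some = find some
  ... | no none with embed A ρ (p · K k s) (λ _ → true) enough
    where
    often : ∀ v → v ∈ K k s → p ≤ size (λ j → matches A ρ j v)
    often v v∈ = ≮⇒≥ (λ few → none (lose v∈ few))
    enough : ∀ v → occ v (p · K k s) ≤ size (λ j → matches A ρ j v)
    enough v = subst (_≤ size (λ j → matches A ρ j v)) (sym (occ-· v p (K k s))) (bounded (1 ≤? occ v (K k s)))
      where
      bounded : Dec (1 ≤ occ v (K k s)) → p * occ v (K k s) ≤ size (λ j → matches A ρ j v)
      bounded (yes v∈) = ≤-trans (*-monoʳ-≤ p (occ-unique v (K k s) (K-unique k s)))
        (subst (_≤ size (λ j → matches A ρ j v)) (sym (*-identityʳ p)) (often v (occ⇒∈ v (K k s) v∈)))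
      bounded (no v∉) = subst (_≤ size (λ j → matches A ρ j v))
        (sym (trans (cong (p *_) (n<1⇒n≡0 (≰⇒> v∉))) (*-zeroʳ p))) z≤n
  ... | γ , γ-injective , _ , γ-match = ⊥-elim (avoids (ρ , γ , inj , γ-injective , λ i q → γ-match q i))

  rowsOf : (M : Vec Bool m) → card M ≡ k → Fin k → Fin m
  rowsOf M e i = enum M (F.cast (sym e) i)

  rowsOf-injective : ∀ M e → Injective (rowsOf M e)
  rowsOf-injective M e x y q = cast-injective (sym e) x y (enum-injective M _ _ q)

  rareColumn : (M : Vec Bool m) → card M ≡ k → Vec (Fin 2) k
  rareColumn M e = proj₁ (rare (rowsOf M e) (rowsOf-injective M e))

  bad : (M : Vec Bool m) → card M ≡ k → Sel n
  bad M e j = matches A (rowsOf M e) j (rareColumn M e)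

  size-bad : ∀ M e → size (bad M e) ≤ p ∸ 1
  size-bad M e = pred-mono-≤ (proj₂ (proj₂ (rare (rowsOf M e) (rowsOf-injective M e))))

  badAmong : (Ms : List (Vec Bool m)) → All (λ M → card M ≡ k) Ms → Sel n
  badAmong [] [] j = false
  badAmong (M ∷ Ms) (e ∷ es) j = bad M e j ∨ badAmong Ms es j

  size-badAmong : ∀ Ms es → size (badAmong Ms es) ≤ L.length Ms * (p ∸ 1)
  size-badAmong [] [] = ≤-reflexive (size-none (badAmong [] []) (λ _ ()))
  size-badAmong (M ∷ Ms) (e ∷ es) =
    ≤-trans (size-∨ (bad M e) (badAmong Ms es)) (+-mono-≤ (size-bad M e) (size-badAmong Ms es))

  badAmong-∈ : ∀ {M} Ms es → M ∈ Ms → Σ (card M ≡ k) λ e → ∀ j → T (bad M e j) → T (badAmong Ms es j)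
  badAmong-∈ (M ∷ Ms) (e ∷ es) (here refl) = e , λ j t → from (T-∨ {bad M e j}) (inj₁ t)
  badAmong-∈ (M′ ∷ Ms) (e ∷ es) (there M∈) with badAmong-∈ Ms es M∈
  ... | e′ , bad⊆ = e′ , λ j t → from (T-∨ {bad M′ e j}) (inj₂ (bad⊆ j t))

  badCols : Sel n
  badCols = badAmong (masks m k) (All.tabulate (masks-sound m k))

  -- Rows ρ′ with image M list the rows of M in some order π; reordering the rare column
  -- of M accordingly gives a column v′ of K k s, and matching v′ on ρ′ is matching the
  -- rare column on the rows of M.
  module Reorder (ρ′ : Fin k → Fin m) (inj′ : Injective ρ′) (e : card (imageMask ρ′) ≡ k) where
    M : Vec Bool m
    M = imageMask ρ′

    ρ : Fin k → Fin m
    ρ = rowsOf M e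

    v : Vec (Fin 2) k
    v = rareColumn M e

    reorder : ∀ i → ∃ λ i₀ → ρ i₀ ≡ ρ′ i
    reorder i with enum-onto M (ρ′ i) (subst T (sym (VP.lookup∘tabulate (inImage ρ′) (ρ′ i))) (inImage-intro ρ′ i))
    ... | i₁ , q = F.cast e i₁ , trans (cong (enum M) (FP.cast-involutive (sym e) e i₁)) q

    π : Fin k → Fin k
    π i = proj₁ (reorder i)

    π-injective : Injective π
    π-injective x y q = inj′ x y (trans (sym (proj₂ (reorder x))) (trans (cong ρ q) (proj₂ (reorder y))))

    v′ : Vec (Fin 2) k
    v′ = V.tabulate (λ i → V.lookup v (π i))

    v′∈K : v′ ∈ K k s
    v′∈K = ∈K v′ (begin
      ones v′                               ≡⟨ ones-∑ v′ ⟩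
      ∑[ i < k ] toℕ (V.lookup v′ i)       ≡⟨ sum-cong-≗ {k} (λ i → cong toℕ (VP.lookup∘tabulate _ i)) ⟩
      ∑[ i < k ] toℕ (V.lookup v (π i))    ≡⟨ ∑-permute k π π-injective (λ i → toℕ (V.lookup v i)) ⟩
      ∑[ i < k ] toℕ (V.lookup v i)        ≡⟨ sym (ones-∑ v) ⟩
      ones v                                ≡⟨ K⇒ones (proj₁ (proj₂ (rare ρ (rowsOf-injective M e)))) ⟩
      s                                     ∎)
      where open ≡-Reasoning

    reordered-match : ∀ j → Match A ρ′ j v′ → Match A ρ j v
    reordered-match j match′ i₀
      with inImage-elim ρ′ (ρ i₀) (subst T (VP.lookup∘tabulate (inImage ρ′) (ρ i₀)) (enum-in M (F.cast (sym e) i₀)))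
    ... | i , ρ′i≡ρi₀ = begin
      toℕ (A (ρ i₀) j)              ≡⟨ cong (λ x → toℕ (A x j)) (sym ρ′i≡ρi₀) ⟩
      toℕ (A (ρ′ i) j)              ≡⟨ match′ i ⟩
      toℕ (V.lookup v′ i)           ≡⟨ cong toℕ (VP.lookup∘tabulate _ i) ⟩
      toℕ (V.lookup v (π i))        ≡⟨ cong (λ x → toℕ (V.lookup v x)) πi≡i₀ ⟩
      toℕ (V.lookup v i₀)           ∎
      where
      open ≡-Reasoning
      πi≡i₀ : π i ≡ i₀
      πi≡i₀ = rowsOf-injective M e (π i) i₀ (trans (proj₂ (reorder i)) ρ′i≡ρi₀)

  good-avoids : AvoidsOn A (not ∘ badCols) (K k s)
  good-avoids ρ′ inj′ matched with badAmong-∈ (masks m k) (All.tabulate (masks-sound m k)) M∈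
    where
    M∈ : imageMask ρ′ ∈ masks m k
    M∈ = subst (λ c → imageMask ρ′ ∈ masks m c) (card-imageMask ρ′ inj′) (masks-complete (imageMask ρ′))
  ... | e , bad⊆ with matched (Reorder.v′ ρ′ inj′ e) (Reorder.v′∈K ρ′ inj′ e)
  ... | j , good , match′ =
    T-not good (bad⊆ j (Match⇒matches A (Reorder.ρ ρ′ inj′ e) j (Reorder.v ρ′ inj′ e)
      (Reorder.reordered-match ρ′ inj′ e j match′)))

  forb-pK-upper : Simple A → n ≤ bound m (2 + r′) k + (p ∸ 1) * (m C k)
  forb-pK-upper simple = begin
    n                                                ≡⟨ size-complement badCols ⟩
    size (not ∘ badCols) + size badCols
      ≤⟨ +-mono-≤ (shifting-bound m k A (not ∘ badCols) (K k s) (λ j j′ _ _ → simple j j′) good-avoids)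
                  (size-badAmong (masks m k) (All.tabulate (masks-sound m k))) ⟩
    bound m (2 + r′) k + L.length (masks m k) * (p ∸ 1)
      ≡⟨ cong (bound m (2 + r′) k +_) (trans (cong (_* (p ∸ 1)) (masks-length m k)) (*-comm (m C k) (p ∸ 1))) ⟩
    bound m (2 + r′) k + (p ∸ 1) * (m C k)           ∎
    where open ≤-Reasoning

size-into-list : ∀ {A : Set} {n} (_≟_ : (x y : A) → Dec (x ≡ y)) (W : List A) (sel : Sel n) (f : Fin n → A) →
  (∀ j → T (sel j) → f j ∈ W) → (∀ j j′ → T (sel j) → T (sel j′) → f j ≡ f j′ → j ≡ j′) →
  size sel ≤ L.length W
size-into-list _≟_ W sel f into distinct = size-pigeonhole (L.length W) sel label label≢0 label-distinct
  where
  label : Fin _ → Fin (suc (L.length W))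
  label j with Any.any? (f j ≟_) W
  ... | yes f∈ = suc (Any.index f∈)
  ... | no _ = zero
  label-spec : ∀ j → T (sel j) → Σ (Fin (L.length W)) λ q → label j ≡ suc q × f j ≡ L.lookup W q
  label-spec j t with Any.any? (f j ≟_) W
  ... | yes f∈ = Any.index f∈ , refl , AnyP.lookup-index f∈
  ... | no f∉ = ⊥-elim (f∉ (into j t))
  label≢0 : ∀ j → T (sel j) → label j ≢ zero
  label≢0 j t e with label-spec j t
  ... | q , e′ , _ with trans (sym e) e′
  ... | ()
  label-distinct : ∀ j j′ → T (sel j) → T (sel j′) → label j ≡ label j′ → j ≡ j′
  label-distinct j j′ t t′ e with label-spec j t | label-spec j′ t′
  ... | q , eq , fj | q′ , eq′ , fj′ = distinct j j′ t t′
    (trans fj (trans (cong (L.lookup W) (FP.suc-injective (trans (sym eq) (trans e eq′)))) (sym fj′)))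

unique-map : ∀ {A B : Set} (f : A → B) {xs} → (∀ {x y} → x ∈ xs → y ∈ xs → f x ≡ f y → x ≡ y) →
  Unique xs → Unique (L.map f xs)
unique-map f {[]} _ [] = []
unique-map f {x ∷ xs} inj (x∉ ∷ u) = All.tabulate fresh ∷ unique-map f (λ p q → inj (there p) (there q)) u
  where
  fresh : ∀ {z} → z ∈ L.map f xs → f x ≢ z
  fresh z∈ e with ∈-map⁻ f z∈
  ... | y , y∈ , refl = All.lookup x∉ y∈ (inj (here refl) (there y∈) e)

∈-take : ∀ {A : Set} n (xs : List A) {x} → x ∈ L.take n xs → x ∈ xs
∈-take (suc n) (y ∷ xs) (here e) = here e
∈-take (suc n) (y ∷ xs) (there x∈) = there (∈-take n xs x∈)

words : (a : ℕ) → ℕ → List (List (Fin a))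
words a zero = [] ∷ []
words a (suc q) = L.cartesianProductWith _∷_ (L.allFin a) (words a q)

words-length : ∀ a q → L.length (words a q) ≡ a ^ q
words-length a zero = refl
words-length a (suc q) = trans (length-cartesianProductWith _∷_ (L.allFin a) (words a q))
  (cong₂ _*_ (LP.length-tabulate (λ (i : Fin a) → i)) (words-length a q))

words-unique : ∀ a q → Unique (words a q)
words-unique a zero = [] ∷ []
words-unique a (suc q) = UP.cartesianProductWith⁺ _∷_ LP.∷-injective (UP.allFin⁺ a) (words-unique a q)

words-∈ : ∀ a q {w} → w ∈ words a q → L.length w ≡ q
words-∈ a zero (here refl) = refl
words-∈ a (suc q) w∈ with ∈-cartesianProductWith⁻ _∷_ (L.allFin a) (words a q) w∈
... | _ , _ , _ , u∈ , refl = cong suc (words-∈ a q u∈)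

-- On the rows of a mask M
-- such a column follows the expected symbols, so each of these rows is a mark; the other
-- rows carry a word over the symbols 2, …, r - 1, which are never marks. Mask and word
-- can be read back off the column.
module Extension (r′ t : ℕ) where
  open Marking r′ t

  isBit : Fin (2 + r′) → Bool
  isBit zero = true
  isBit (suc zero) = true
  isBit (suc (suc _)) = false

  support : ∀ {m} → Vec (Fin (2 + r′)) m → Vec Bool m
  support = V.map isBit

  filling : ∀ {m} → Vec (Fin (2 + r′)) m → List (Fin r′)
  filling [] = []
  filling (zero ∷ x) = filling x
  filling (suc zero ∷ x) = filling x
  filling (suc (suc a) ∷ x) = a ∷ filling x

  Fits : ∀ {m} → Vec Bool m → List (Fin r′) → Set
  Fits [] [] = ⊤
  Fits [] (_ ∷ _) = ⊥
  Fits (true ∷ M) w = Fits M w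
  Fits (false ∷ M) [] = ⊥
  Fits (false ∷ M) (a ∷ w) = Fits M w

  fits : ∀ {m} (M : Vec Bool m) w → L.length w + card M ≡ m → Fits M w
  fits [] [] e = tt
  fits (true ∷ M) w e = fits M w (suc-injective (trans (sym (+-suc (L.length w) (card M))) e))
  fits (false ∷ M) (a ∷ w) e = fits M w (suc-injective e)
  fits {suc m} (false ∷ M) [] e = ⊥-elim (<-irrefl e (s≤s (size-≤ (V.lookup M))))

  column : ∀ {m} → Vec Bool m → ℕ → List (Fin r′) → Vec (Fin (2 + r′)) m
  column [] c w = []
  column (true ∷ M) c w = expected c ∷ column M (suc c) w
  column (false ∷ M) c [] = expected c ∷ column M c []
  column (false ∷ M) c (a ∷ w) = suc (suc a) ∷ column M c w

  support-column : ∀ {m} (M : Vec Bool m) c w → Fits M w → support (column M c w) ≡ M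
  support-column [] c [] _ = refl
  support-column (true ∷ M) c w f = cong₂ _∷_ (isBit-bit (t ≤ᵇ c)) (support-column M (suc c) w f)
    where
    isBit-bit : ∀ b → isBit (bit b) ≡ true
    isBit-bit true = refl
    isBit-bit false = refl
  support-column (false ∷ M) c (a ∷ w) f = cong (false ∷_) (support-column M c w f)

  filling-column : ∀ {m} (M : Vec Bool m) c w → Fits M w → filling (column M c w) ≡ w
  filling-column [] c [] _ = refl
  filling-column (true ∷ M) c w f = trans (filling-bit (t ≤ᵇ c) (column M (suc c) w)) (filling-column M (suc c) w f)
    where
    filling-bit : ∀ {m} b (x : Vec (Fin (2 + r′)) m) → filling (bit b ∷ x) ≡ filling x
    filling-bit true x = refl
    filling-bit false x = refl
  filling-column (false ∷ M) c (a ∷ w) f = cong (a ∷_) (filling-column M c w f)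

  big≢bit : ∀ a b → suc (suc a) ≢ bit {r′} b
  big≢bit a true ()
  big≢bit a false ()

  marks-column : ∀ {m} (M : Vec Bool m) c w → Fits M w → marks c (column M c w) ≡ card M + c
  marks-column [] c [] _ = refl
  marks-column (true ∷ M) c w f rewrite ind-==-refl (expected c) =
    trans (marks-column M (suc c) w f) (+-suc (card M) c)
  marks-column (false ∷ M) c (a ∷ w) f rewrite ind-==-≢ (suc (suc a)) (expected c) (big≢bit a (t ≤ᵇ c)) =
    marks-column M c w f

  extraColumns : ∀ {m} → List (Vec Bool m) → List (List (Fin r′)) → List (Vec (Fin (2 + r′)) m)
  extraColumns Ms W = L.map (λ (M , w) → column M 0 w) (L.cartesianProduct Ms W)

  extraColumns-∈ : ∀ {m} (Ms : List (Vec Bool m)) W {x} → x ∈ extraColumns Ms W →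
    ∃₂ λ M w → M ∈ Ms × w ∈ W × x ≡ column M 0 w
  extraColumns-∈ Ms W x∈ with ∈-map⁻ (λ (M , w) → column M 0 w) x∈
  ... | (M , w) , Mw∈ , refl = let M∈ , w∈ = ∈-cartesianProduct⁻ Ms W Mw∈ in M , w , M∈ , w∈ , refl

  extraColumns-length : ∀ {m} (Ms : List (Vec Bool m)) W → L.length (extraColumns Ms W) ≡ L.length Ms * L.length W
  extraColumns-length Ms W = trans (LP.length-map _ (L.cartesianProduct Ms W)) (length-cartesianProductWith _,_ Ms W)

  extraColumns-unique : ∀ {m} (Ms : List (Vec Bool m)) W → Unique Ms → Unique W →
    (∀ {M w} → M ∈ Ms → w ∈ W → Fits M w) → Unique (extraColumns Ms W)
  extraColumns-unique Ms W uMs uW fit = unique-map _ injective (UP.cartesianProduct⁺ uMs uW)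
    where
    injective : ∀ {x y} → x ∈ L.cartesianProduct Ms W → y ∈ L.cartesianProduct Ms W →
      column (proj₁ x) 0 (proj₂ x) ≡ column (proj₁ y) 0 (proj₂ y) → x ≡ y
    injective {M , w} {M′ , w′} x∈ y∈ e with ∈-cartesianProduct⁻ Ms W x∈ | ∈-cartesianProduct⁻ Ms W y∈
    ... | M∈ , w∈ | M′∈ , w′∈ = cong₂ _,_
      (trans (sym (support-column M 0 w (fit M∈ w∈))) (trans (cong support e) (support-column M′ 0 w′ (fit M′∈ w′∈))))
      (trans (sym (filling-column M 0 w (fit M∈ w∈))) (trans (cong filling e) (filling-column M′ 0 w′ (fit M′∈ w′∈))))

module PartTwoConstruction (r′ m k s p : ℕ) where
  open Marking r′ (k ∸ s)
  open Extension r′ (k ∸ s)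

  W : List (List (Fin r′))
  W = L.take (p ∸ 1) (words r′ (m ∸ k))

  extra : List (Vec (Fin (2 + r′)) m)
  extra = extraColumns (masks m k) W

  cols : List (Vec (Fin (2 + r′)) m)
  cols = fewMarks m 0 k ++ extra

  fits-W : ∀ {M w} → M ∈ masks m k → w ∈ W → Fits M w
  fits-W {M} {w} M∈ w∈ = fits M w (begin
    L.length w + card M ≡⟨ cong₂ _+_ (words-∈ r′ (m ∸ k) (∈-take (p ∸ 1) _ w∈)) card≡k ⟩
    (m ∸ k) + k         ≡⟨ m∸n+n≡m (subst (_≤ m) card≡k (size-≤ (V.lookup M))) ⟩
    m                   ∎)
    where
    open ≡-Reasoning
    card≡k = masks-sound m k M∈

  extra-marks : ∀ x → x ∈ extra → marks 0 x ≡ k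
  extra-marks x x∈ with extraColumns-∈ (masks m k) W x∈
  ... | M , w , M∈ , w∈ , refl = trans (marks-column M 0 w (fits-W M∈ w∈)) (trans (+-identityʳ _) (masks-sound m k M∈))

  cols-unique : Unique cols
  cols-unique = UP.++⁺ (fewMarks-unique m 0 k)
    (extraColumns-unique (masks m k) W (masks-unique m k) (UP.take⁺ (p ∸ 1) (words-unique r′ (m ∸ k))) fits-W) disjoint
    where
    disjoint : ∀ {x} → x ∈ fewMarks m 0 k × x ∈ extra → ⊥
    disjoint {x} (x∈ˡ , x∈ʳ) =
      <-irrefl (extra-marks x x∈ʳ) (subst (marks 0 x <_) (+-identityʳ k) (fewMarks-marks m 0 k x x∈ˡ))

  -- Under the hypothesis of the theorem there are p ∸ 1 words per k-mask (when k ≤ m).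
  extra-length : (p ∸ 1) * (r′ ^ (k ∸ m)) ≤ r′ ^ (m ∸ k) → L.length extra ≡ (p ∸ 1) * (m C k)
  extra-length hyp with k ≤? m
  ... | yes k≤m = trans (extraColumns-length (masks m k) W)
    (trans (cong₂ _*_ (masks-length m k) W-length) (*-comm (m C k) (p ∸ 1)))
    where
    enough-words : p ∸ 1 ≤ L.length (words r′ (m ∸ k))
    enough-words = subst (p ∸ 1 ≤_) (sym (words-length r′ (m ∸ k)))
      (subst (_≤ r′ ^ (m ∸ k)) (trans (cong (λ z → (p ∸ 1) * r′ ^ z) (m≤n⇒m∸n≡0 k≤m)) (*-identityʳ (p ∸ 1)))
        hyp)
    W-length : L.length W ≡ p ∸ 1
    W-length = trans (LP.length-take (p ∸ 1) (words r′ (m ∸ k))) (m≤n⇒m⊓n≡m enough-words)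
  ... | no k≰m = trans (extraColumns-length (masks m k) W)
    (trans (cong (_* L.length W) (trans (masks-length m k) C≡0))
      (sym (trans (cong ((p ∸ 1) *_) C≡0) (*-zeroʳ (p ∸ 1)))))
    where
    C≡0 : m C k ≡ 0
    C≡0 = k>n⇒nCk≡0 (≰⇒> k≰m)

  -- A column of the construction agreeing with the pattern of ρ is an extra column of the
  -- image of ρ: it is not among the columns with few marks, and its mask contains the
  -- image of ρ (those entries are 0 or 1) and has the same cardinality.
  pattern-columns : ∀ {x} (ρ : Fin k → Fin m) → Injective ρ → x ∈ cols →
    (∀ i → toℕ (V.lookup x (ρ i)) ≡ toℕ (V.lookup (patternOf ρ) i)) →
    ∃ λ w → w ∈ W × Fits (imageMask ρ) w × x ≡ column (imageMask ρ) 0 w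
  pattern-columns {x} ρ inj x∈ agree with ∈-++⁻ (fewMarks m 0 k) x∈
  ... | inj₁ x∈ˡ = ⊥-elim (fewMarks-mismatch ρ inj x x∈ˡ agree)
  ... | inj₂ x∈ʳ with extraColumns-∈ (masks m k) W x∈ʳ
  ... | M , w , M∈ , w∈ , refl = w , w∈ , subst (λ M′ → Fits M′ w) (sym M≡) (fits-W M∈ w∈) ,
                                 cong (λ M′ → column M′ 0 w) (sym M≡)
    where
    bit-entry : ∀ (a : Fin (2 + r′)) (b : Fin 2) → toℕ a ≡ toℕ b → T (isBit a)
    bit-entry zero b e = tt
    bit-entry (suc zero) b e = tt
    bit-entry (suc (suc a)) zero ()
    bit-entry (suc (suc a)) (suc zero) ()
    image⊆M : ∀ j → T (V.lookup (imageMask ρ) j) → T (V.lookup M j)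
    image⊆M j t with inImage-elim ρ j (subst T (VP.lookup∘tabulate (inImage ρ) j) t)
    ... | i , refl = subst T
      (trans (sym (VP.lookup-map (ρ i) isBit (column M 0 w)))
        (cong (λ N → V.lookup N (ρ i)) (support-column M 0 w (fits-W M∈ w∈))))
      (bit-entry _ _ (agree i))
    M≡ : imageMask ρ ≡ M
    M≡ = mask-eq (imageMask ρ) M image⊆M (trans (card-imageMask ρ inj) (sym (masks-sound m k M∈)))

  -- In a supposed copy (ρ, γ) of p · K k s, the columns that are copies of the pattern of ρ
  -- are extra columns of the image of ρ, determined by their filling word: at most p ∸ 1
  -- of them, while p · K k s contains the pattern p times.
  module PatternCopies {N} (e : L.length cols ≡ N) (s≤k : s ≤ k) (ρ : Fin k → Fin m) (injρ : Injective ρ)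
    (γ : Fin (L.length (p · K k s)) → Fin N) (injγ : Injective γ)
    (match : ∀ i j → toℕ (listMatrix cols e (ρ i) (γ j)) ≡ toℕ (V.lookup (L.lookup (p · K k s) j) i)) where
    v : Vec (Fin 2) k
    v = patternOf ρ

    col : Fin (L.length (p · K k s)) → Vec (Fin (2 + r′)) m
    col j = L.lookup cols (F.cast (sym e) (γ j))

    copies : Sel (L.length (p · K k s))
    copies j = v ==ᵥ L.lookup (p · K k s) j

    copy-shape : ∀ j → T (copies j) → ∃ λ w → w ∈ W × Fits (imageMask ρ) w × col j ≡ column (imageMask ρ) 0 w
    copy-shape j t = pattern-columns ρ injρ (∈-lookup _)
      (λ i → trans (match i j) (cong (λ u → toℕ (V.lookup u i)) (sym (==ᵥ⇒≡ v _ t))))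

    filling-copy : ∀ j (t : T (copies j)) → filling (col j) ≡ proj₁ (copy-shape j t)
    filling-copy j t = let w , _ , f , col≡ = copy-shape j t in trans (cong filling col≡) (filling-column (imageMask ρ) 0 w f)

    copies-distinct : ∀ j j′ → T (copies j) → T (copies j′) → filling (col j) ≡ filling (col j′) → j ≡ j′
    copies-distinct j j′ t t′ same with copy-shape j t | copy-shape j′ t′ | filling-copy j t | filling-copy j′ t′
    ... | w , _ , _ , col≡ | w′ , _ , _ , col≡′ | fj | fj′ =
      injγ j j′ (cast-injective (sym e) _ _ (unique-lookup cols-unique _ _
        (trans col≡ (trans (cong (column (imageMask ρ) 0) (trans (sym fj) (trans same fj′))) (sym col≡′)))))

    few-copies : size copies ≤ p ∸ 1
    few-copies = ≤-trans (size-into-list (LP.≡-dec FP._≟_) W copies (filling ∘ col)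
        (λ j t → subst (_∈ W) (sym (filling-copy j t)) (proj₁ (proj₂ (copy-shape j t)))) copies-distinct)
      (≤-trans (≤-reflexive (LP.length-take (p ∸ 1) (words r′ (m ∸ k)))) (m⊓n≤m (p ∸ 1) _))

    many-copies : p ≤ size copies
    many-copies = begin
      p                     ≡⟨ sym (*-identityʳ p) ⟩
      p * 1                 ≤⟨ *-monoʳ-≤ p (∈⇒occ (patternOf∈K refl s≤k ρ injρ)) ⟩
      p * occ v (K k s)     ≡⟨ sym (occ-· v p (K k s)) ⟩
      occ v (p · K k s)     ≡⟨ sym (occ-size v (p · K k s)) ⟩
      size copies           ∎
      where open ≤-Reasoning

  avoids : ∀ {N} (e : L.length cols ≡ N) → 1 ≤ p → s ≤ k → Avoids (listMatrix cols e) (p · K k s)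
  avoids e 1≤p s≤k (ρ , γ , injρ , injγ , match) = p≰p∸1 1≤p (≤-trans many-copies few-copies)
    where
    open PatternCopies e s≤k ρ injρ γ injγ match
    p≰p∸1 : ∀ {p} → 1 ≤ p → ¬ (p ≤ p ∸ 1)
    p≰p∸1 {suc p} _ p<p = <-irrefl refl p<p

forb-pK : ∀ r′ m k s p → s ≤ k → 1 ≤ p → (p ∸ 1) * (r′ ^ (k ∸ m)) ≤ r′ ^ (m ∸ k) →
  IsForb m (2 + r′) (p · K k s) (bound m (2 + r′) k + (p ∸ 1) * (m C k))
forb-pK r′ m k s p s≤k 1≤p hyp =
  (listMatrix cols len , listMatrix-simple cols len cols-unique , avoids len 1≤p s≤k) ,
  (λ n A simple avoids′ → RareColumns.forb-pK-upper A avoids′ simple)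
  where
  open PartTwoConstruction r′ m k s p
  len : L.length cols ≡ bound m (2 + r′) k + (p ∸ 1) * (m C k)
  len = trans (LP.length-++ (Marking.fewMarks r′ (k ∸ s) m 0 k))
    (cong₂ _+_ (Marking.fewMarks-length r′ (k ∸ s) m 0 k) (extra-length hyp))

proposition3p3 : (r m k s : ℕ) → 2 ≤ r → 1 ≤ m → 1 ≤ k → s ≤ k →
    IsForb m r (K k s) (bound m r k) ×
    ((p : ℕ) → 1 ≤ p → (p ∸ 1) * ((r ∸ 2) ^ (k ∸ m)) ≤ (r ∸ 2) ^ (m ∸ k) →
      IsForb m r (p · K k s) (bound m r k + (p ∸ 1) * (m C k)))
proposition3p3 (suc zero) m k s (s≤s ()) _ _ _
proposition3p3 (suc (suc r′)) m k s _ _ _ s≤k =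
  forb-K r′ m k s s≤k , λ p 1≤p hyp → forb-pK r′ m k s p s≤k 1≤p hyp
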